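{- Let $q$ be an odd prime power and consider $PG(2,q)$ with the quadratic form $Q(X)=x_0^2-x_1^2+\alpha x_2^2$, where $\alpha$ is a nonzero square in $\mathbb{F}_q$. Let $\mathbf{A}_{11}$ be the square $0/1$ matrix whose rows are indexed by the lines $P^{\perp}$ and whose columns are indexed by the points $R$, where $P$ and $R$ range over the anisotropic points (rows and columns listed in the same order of points), with entry $1$ iff $\langle P,R\rangle=0$. Viewing $\mathbf{A}_{11}$ as a matrix over $\mathbb{F}_2$, we have $(\mathbf{A}_{11})^{4}=\mathbf{J}-\mathbf{I}$, where $\mathbf{J}$ is the all-one matrix and $\mathbf{I}$ the identity matrix of the same order.
   Context: Points of $PG(2,q)$ are $1$-dimensional subspaces of $\mathbb{F}_q^3$; the bilinear form is $\langle X,Y\rangle=x_0y_0-x_1y_1+\alpha x_2y_2$ and $P^\perp=\{R:\langle P,R\rangle=0\}$. A point $P$ is anisotropic if $Q(P)\neq 0$. -}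

module Defs where

open import Level using (0ℓ)
open import Algebra.Bundles using (CommutativeRing)
open import Data.Nat using (ℕ; _≤_; _^_)
open import Data.Nat.Primality using (Prime)
open import Data.Product using (Σ; ∃; _×_; _,_)
open import Data.Bool using (Bool; true; false; _xor_; _∧_; if_then_else_)
open import Data.Fin as Fin using (Fin)
open import Data.Vec using (Vec)
open import Data.List using (List; []; _∷_; _++_; map; concatMap; filter; length; lookup)
import Data.Vec.Functional as VF
open import Relation.Nullary using (¬_; ¬?)
open import Relation.Nullary.Decidable using (⌊_⌋)
open import Relation.Binary using (Decidable)
open import Relation.Binary.PropositionalEquality using (_≡_)

IsPrimePower : ℕ → Set
IsPrimePower q = Σ ℕ λ p → Σ ℕ λ k → Prime p × (1 ≤ k) × (q ≡ p ^ k)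

record FiniteField (q : ℕ) : Set₁ where
  field
    commRing : CommutativeRing 0ℓ 0ℓ
  open CommutativeRing commRing public
  field
    1≉0      : ¬ (1# ≈ 0#)
    inverse  : ∀ x → ¬ (x ≈ 0#) → ∃ λ y → (x * y) ≈ 1#
    _≟_      : Decidable _≈_
    elems    : Vec Carrier q
    complete : ∀ x → ∃ λ (i : Fin q) → x ≈ Data.Vec.lookup elems i
    distinct : ∀ i j → Data.Vec.lookup elems i ≈ Data.Vec.lookup elems j → i ≡ j

-- Matrices over F₂ (F₂ = Bool with xor as + and ∧ as ·), indexed by Fin n.
Mat₂ : ℕ → Set
Mat₂ n = Fin n → Fin n → Bool

_⊗_ : ∀ {n} → Mat₂ n → Mat₂ n → Mat₂ n
(A ⊗ B) i j = VF.foldr _xor_ false (λ k → A i k ∧ B k j)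

J₂ I₂ J-I : ∀ {n} → Mat₂ n
J₂ i j = true
I₂ i j = if ⌊ i Fin.≟ j ⌋ then true else false
J-I i j = J₂ i j xor I₂ i j   -- over F₂, −1 = 1

module PG2 {q : ℕ} (F : FiniteField q) (α : FiniteField.Carrier F) where
  open FiniteField F

  Vec3 : Set
  Vec3 = Carrier × Carrier × Carrier

  ⟨_,_⟩ : Vec3 → Vec3 → Carrier
  ⟨ (x₀ , x₁ , x₂) , (y₀ , y₁ , y₂) ⟩ = ((x₀ * y₀) - (x₁ * y₁)) + (α * (x₂ * y₂))

  Q : Vec3 → Carrier
  Q X = ⟨ X , X ⟩

  elemList : List Carrier
  elemList = Data.Vec.toList elems

  -- The points of PG(2,q), each given by its canonical (normalised)
  -- representative: (1,a,b), (0,1,b), (0,0,1).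
  points : List Vec3
  points = concatMap (λ a → map (λ b → (1# , a , b)) elemList) elemList
        ++ map (λ b → (0# , 1# , b)) elemList
        ++ ((0# , 0# , 1#) ∷ [])

  aniso : List Vec3
  aniso = filter (λ P → ¬? (Q P ≟ 0#)) points

  N : ℕ
  N = length aniso

  pt : Fin N → Vec3
  pt = lookup aniso

  -- A₁₁: row of P (the line P^⊥), column of R, entry 1 iff ⟨P,R⟩ = 0
  A₁₁ : Mat₂ N
  A₁₁ i j = if ⌊ ⟨ pt i , pt j ⟩ ≟ 0# ⌋ then true else false

{-# OPTIONS --safe #-}
module Submission where

-- Over F₂, let B be the incidence matrix of all points and lines of PG(2,q), B_{PR} = [⟨P,R⟩ = 0].
-- Two distinct points lie on one common line and a line has q + 1 points, an even number, so
-- B² = J - I. Dropping the isotropic points S from ∑_S B_{PS} B_{SR} gives A₁₁² = J - I + K, where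
-- K_{PR} counts the points of the conic Q = 0 on both polars P^⊥ and R^⊥. A tangent meets the conic
-- once and any other line meets it in 0 or 2 points (on P^⊥ the form Q has discriminant -α Q(P) ≠ 0).
-- Hence there is an odd number of anisotropic points, every conic point lies on an odd number of
-- anisotropic polars, and ∑_S K_{PS} = ∑_S K_{PS} K_{SR} = 0 over anisotropic S. Expanding
-- (J - I + K)² with these facts leaves J - I.

open import Level using (0ℓ)
open import Algebra.Bundles using (CommutativeRing)
open import Defs
open import Data.Nat using (ℕ)
open import Data.Nat.DivMod using (_%_)
open import Data.Product using (∃; _×_)
open import Data.Fin using (Fin)
open import Relation.Nullary using (¬_)
open import Relation.Binary.PropositionalEquality using (_≡_)

-- The ring solver of the standard library normalises with coefficients from a ring mapping
-- into the carrier; for an abstract commutative ring these are the integers.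
module IntegerCoefficients (R : CommutativeRing 0ℓ 0ℓ) where

  open import Data.Nat as ℕ using (zero; suc)
  open import Data.Integer as ℤ using (ℤ; +_; -[1+_]; _⊖_)
  import Data.Integer.Properties as ℤ
  open import Data.Sign as Sign using (Sign)
  open import Data.Maybe using (Maybe; just; nothing)
  open import Relation.Nullary using (yes; no)
  import Relation.Binary.PropositionalEquality as ≡
  open import Algebra.Solver.Ring.AlmostCommutativeRing
    using (fromCommutativeRing; _-Raw-AlmostCommutative⟶_)

  open CommutativeRing R
  open import Algebra.Properties.Ring ring
    using (-‿involutive; -0#≈0#; -‿distribˡ-*; -‿distribʳ-*)
  open import Algebra.Properties.AbelianGroup +-abelianGroup using (⁻¹-∙-comm)
  open import Algebra.Properties.CommutativeSemigroup +-commutativeSemigroup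
    using (interchange; x∙yz≈y∙xz)
  open import Algebra.Properties.Semiring.Mult semiring
    using (×-homo-+; ×1-homo-*) renaming (_×_ to _·_)
  open import Relation.Binary.Reasoning.Setoid setoid

  fromℤ : ℤ → Carrier
  fromℤ (+ n)    = n · 1#
  fromℤ -[1+ n ] = - (suc n · 1#)

  [1+x]-[1+y]≈x-y : ∀ x y → (1# + x) - (1# + y) ≈ x - y
  [1+x]-[1+y]≈x-y x y = begin
    (1# + x) - (1# + y)      ≈⟨ +-congˡ (⁻¹-∙-comm 1# y) ⟨
    (1# + x) + (- 1# + - y)  ≈⟨ interchange 1# x (- 1#) (- y) ⟩
    (1# - 1#) + (x - y)      ≈⟨ +-congʳ (-‿inverseʳ 1#) ⟩
    0# + (x - y)             ≈⟨ +-identityˡ (x - y) ⟩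
    x - y                    ∎

  ⊖-homo : ∀ m n → fromℤ (m ⊖ n) ≈ m · 1# - n · 1#
  ⊖-homo zero    zero    = sym (-‿inverseʳ 0#)
  ⊖-homo zero    (suc n) = sym (+-identityˡ _)
  ⊖-homo (suc m) zero    = sym (trans (+-congˡ -0#≈0#) (+-identityʳ _))
  ⊖-homo (suc m) (suc n) = begin
    fromℤ (suc m ⊖ suc n)     ≡⟨ ≡.cong fromℤ (ℤ.[1+m]⊖[1+n]≡m⊖n m n) ⟩
    fromℤ (m ⊖ n)             ≈⟨ ⊖-homo m n ⟩
    m · 1# - n · 1#           ≈⟨ [1+x]-[1+y]≈x-y _ _ ⟨
    suc m · 1# - suc n · 1#   ∎

  +-homo : ∀ i j → fromℤ (i ℤ.+ j) ≈ fromℤ i + fromℤ j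
  +-homo (+ m)    (+ n)    = ×-homo-+ 1# m n
  +-homo (+ m)    -[1+ n ] = ⊖-homo m (suc n)
  +-homo -[1+ m ] (+ n)    = trans (⊖-homo n (suc m)) (+-comm _ _)
  +-homo -[1+ m ] -[1+ n ] = begin
    - (suc (suc m ℕ.+ n) · 1#)          ≈⟨ -‿cong (+-congˡ (×-homo-+ 1# (suc m) n)) ⟩
    - (1# + (suc m · 1# + n · 1#))      ≈⟨ -‿cong (x∙yz≈y∙xz 1# (suc m · 1#) (n · 1#)) ⟩
    - (suc m · 1# + suc n · 1#)         ≈⟨ ⁻¹-∙-comm _ _ ⟨
    - (suc m · 1#) + - (suc n · 1#)     ∎

  -‿homo : ∀ i → fromℤ (ℤ.- i) ≈ - fromℤ i
  -‿homo (+ zero)  = sym -0#≈0#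
  -‿homo (+ suc n) = refl
  -‿homo -[1+ n ]  = sym (-‿involutive _)

  signed : Sign → Carrier → Carrier
  signed Sign.+ x = x
  signed Sign.- x = - x

  ◃-homo : ∀ s n → fromℤ (s ℤ.◃ n) ≈ signed s (n · 1#)
  ◃-homo Sign.+ zero    = refl
  ◃-homo Sign.- zero    = sym -0#≈0#
  ◃-homo Sign.+ (suc n) = refl
  ◃-homo Sign.- (suc n) = refl

  *-homo : ∀ i j → fromℤ (i ℤ.* j) ≈ fromℤ i * fromℤ j
  *-homo (+ m)    (+ n)    = trans (◃-homo Sign.+ (m ℕ.* n)) (×1-homo-* m n)
  *-homo (+ m)    -[1+ n ] = begin
    fromℤ (Sign.- ℤ.◃ m ℕ.* suc n)    ≈⟨ ◃-homo Sign.- (m ℕ.* suc n) ⟩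
    - ((m ℕ.* suc n) · 1#)            ≈⟨ -‿cong (×1-homo-* m (suc n)) ⟩
    - (m · 1# * suc n · 1#)           ≈⟨ -‿distribʳ-* _ _ ⟩
    m · 1# * - (suc n · 1#)           ∎
  *-homo -[1+ m ] (+ n)    = begin
    fromℤ (Sign.- ℤ.◃ suc m ℕ.* n)    ≈⟨ ◃-homo Sign.- (suc m ℕ.* n) ⟩
    - ((suc m ℕ.* n) · 1#)            ≈⟨ -‿cong (×1-homo-* (suc m) n) ⟩
    - (suc m · 1# * n · 1#)           ≈⟨ -‿distribˡ-* _ _ ⟩
    - (suc m · 1#) * n · 1#           ∎
  *-homo -[1+ m ] -[1+ n ] = begin
    (suc m ℕ.* suc n) · 1#            ≈⟨ ×1-homo-* (suc m) (suc n) ⟩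
    suc m · 1# * suc n · 1#           ≈⟨ -‿involutive _ ⟨
    - - (suc m · 1# * suc n · 1#)     ≈⟨ -‿cong (-‿distribˡ-* _ _) ⟩
    - (- (suc m · 1#) * suc n · 1#)   ≈⟨ -‿distribʳ-* _ _ ⟩
    - (suc m · 1#) * - (suc n · 1#)   ∎

  homomorphism : ℤ.+-*-rawRing -Raw-AlmostCommutative⟶ fromCommutativeRing R
  homomorphism = record
    { ⟦_⟧ = fromℤ ; +-homo = +-homo ; *-homo = *-homo ; -‿homo = -‿homo
    ; 0-homo = refl ; 1-homo = +-identityʳ 1# }

  fromℤ-≟ : ∀ i j → Maybe (fromℤ i ≈ fromℤ j)
  fromℤ-≟ i j with i ℤ.≟ j
  ... | yes ≡.refl = just refl
  ... | no _       = nothing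

  open import Algebra.Solver.Ring ℤ.+-*-rawRing (fromCommutativeRing R) homomorphism fromℤ-≟ public

module F₂Sums where

  open import Data.Nat as ℕ using (zero; suc)
  open import Data.Bool using (Bool; true; false; _xor_; _∧_)
  open import Data.Bool.Properties using
    (xor-∧-commutativeRing; xor-assoc; ∧-assoc; ∧-distribˡ-xor; ∧-distribʳ-xor; ∧-zeroʳ; xor-identityʳ;
     not-involutive)
  open import Data.Fin as Fin using (zero; suc)
  open import Function using (_∘_)
  open import Data.Fin.Properties using (suc-injective)
  open import Data.Vec as Vec using (Vec)
  open import Data.List using (List; []; _∷_; _++_; map; concatMap; filter; lookup)
  open import Data.List.Relation.Unary.All as All using (All; []; _∷_)
  open import Data.List.Relation.Unary.AllPairs using (AllPairs; []; _∷_)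
  open import Data.List.Relation.Unary.Any using (here; there)
  open import Data.List.Membership.Propositional using (_∈_)
  open import Relation.Nullary using (does)
  open import Relation.Unary using (Pred; Decidable)
  open import Algebra.Properties.CommutativeSemigroup
    (CommutativeRing.+-commutativeSemigroup xor-∧-commutativeRing) using (interchange)
  open import Relation.Binary.PropositionalEquality
  open ≡-Reasoning

  open import Algebra.Properties.Semiring.Sum (CommutativeRing.semiring xor-∧-commutativeRing)
    using (sum; sum-cong-≗; ∑-distrib-+; ∑-comm; sum-replicate-zero;
           *-distribˡ-sum; *-distribʳ-sum; sum-permute) public

  ∑-∧ˡ : ∀ {n} b (f : Fin n → Bool) → sum (λ i → b ∧ f i) ≡ b ∧ sum f
  ∑-∧ˡ b f = sym (*-distribˡ-sum b f)

  ∑-∧ʳ : ∀ {n} b (f : Fin n → Bool) → sum (λ i → f i ∧ b) ≡ sum f ∧ b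
  ∑-∧ʳ b f = sym (*-distribʳ-sum b f)

  ∑-single : ∀ {n} (f : Fin n → Bool) k → (∀ i → i ≢ k → f i ≡ false) → sum f ≡ f k
  ∑-single {suc n} f zero     vanish = begin
    f zero xor sum (f ∘ suc)          ≡⟨ cong (f zero xor_) (sum-cong-≗ (λ i → vanish (suc i) λ ())) ⟩
    f zero xor sum {n} (λ _ → false)  ≡⟨ cong (f zero xor_) (sum-replicate-zero n) ⟩
    f zero xor false                  ≡⟨ xor-identityʳ (f zero) ⟩
    f zero                            ∎
  ∑-single {suc n} f (suc k) vanish = begin
    f zero xor sum (f ∘ suc)          ≡⟨ cong (_xor sum (f ∘ suc)) (vanish zero λ ()) ⟩
    sum (f ∘ suc)                     ≡⟨ ∑-single (f ∘ suc) k (λ i i≢k → vanish (suc i) (i≢k ∘ suc-injective)) ⟩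
    f (suc k)                         ∎

  ∑-true-odd : ∀ n → n % 2 ≡ 1 → sum {n} (λ _ → true) ≡ true
  ∑-true-odd (suc zero)    _   = refl
  ∑-true-odd (suc (suc n)) odd = trans (not-involutive _) (∑-true-odd n odd)

  private variable A B : Set

  sumL : (A → Bool) → List A → Bool
  sumL f []       = false
  sumL f (x ∷ xs) = f x xor sumL f xs

  sumL-cong : ∀ {f g : A → Bool} {xs} → All (λ x → f x ≡ g x) xs → sumL f xs ≡ sumL g xs
  sumL-cong []       = refl
  sumL-cong (e ∷ es) = cong₂ _xor_ e (sumL-cong es)

  sumL-zero : ∀ (xs : List A) → sumL (λ _ → false) xs ≡ false
  sumL-zero []       = refl
  sumL-zero (x ∷ xs) = sumL-zero xs

  sumL-xor : ∀ (f g : A → Bool) xs → sumL (λ x → f x xor g x) xs ≡ sumL f xs xor sumL g xs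
  sumL-xor f g []       = refl
  sumL-xor f g (x ∷ xs) =
    trans (cong ((f x xor g x) xor_) (sumL-xor f g xs)) (interchange (f x) (g x) _ _)

  sumL-∧ˡ : ∀ b (f : A → Bool) xs → sumL (λ x → b ∧ f x) xs ≡ b ∧ sumL f xs
  sumL-∧ˡ b f []       = sym (∧-zeroʳ b)
  sumL-∧ˡ b f (x ∷ xs) =
    trans (cong (b ∧ f x xor_) (sumL-∧ˡ b f xs)) (sym (∧-distribˡ-xor b _ _))

  sumL-∧ʳ : ∀ b (f : A → Bool) xs → sumL (λ x → f x ∧ b) xs ≡ sumL f xs ∧ b
  sumL-∧ʳ b f []       = refl
  sumL-∧ʳ b f (x ∷ xs) =
    trans (cong (f x ∧ b xor_) (sumL-∧ʳ b f xs)) (sym (∧-distribʳ-xor b (f x) (sumL f xs)))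

  sumL-comm : ∀ (f : A → B → Bool) xs ys →
    sumL (λ x → sumL (f x) ys) xs ≡ sumL (λ y → sumL (λ x → f x y) xs) ys
  sumL-comm f []       ys = sym (sumL-zero ys)
  sumL-comm f (x ∷ xs) ys = begin
    sumL (f x) ys xor sumL (λ x → sumL (f x) ys) xs        ≡⟨ cong (sumL (f x) ys xor_) (sumL-comm f xs ys) ⟩
    sumL (f x) ys xor sumL (λ y → sumL (λ x → f x y) xs) ys ≡⟨ sumL-xor (f x) _ ys ⟨
    sumL (λ y → f x y xor sumL (λ x → f x y) xs) ys        ∎

  sumL-++ : ∀ (f : A → Bool) xs ys → sumL f (xs ++ ys) ≡ sumL f xs xor sumL f ys
  sumL-++ f []       ys = refl
  sumL-++ f (x ∷ xs) ys = trans (cong (f x xor_) (sumL-++ f xs ys)) (sym (xor-assoc (f x) _ _))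

  sumL-map : ∀ (f : A → Bool) (g : B → A) xs → sumL f (map g xs) ≡ sumL (f ∘ g) xs
  sumL-map f g []       = refl
  sumL-map f g (x ∷ xs) = cong (f (g x) xor_) (sumL-map f g xs)

  sumL-concatMap : ∀ (f : A → Bool) (g : B → List A) xs →
    sumL f (concatMap g xs) ≡ sumL (λ x → sumL f (g x)) xs
  sumL-concatMap f g []       = refl
  sumL-concatMap f g (x ∷ xs) =
    trans (sumL-++ f (g x) (concatMap g xs)) (cong (sumL f (g x) xor_) (sumL-concatMap f g xs))

  sumL-filter : ∀ {P : Pred A 0ℓ} (P? : Decidable P) (f : A → Bool) xs →
    sumL f (filter P? xs) ≡ sumL (λ x → does (P? x) ∧ f x) xs
  sumL-filter P? f []       = refl
  sumL-filter P? f (x ∷ xs) with does (P? x)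
  ... | true  = cong (f x xor_) (sumL-filter P? f xs)
  ... | false = sumL-filter P? f xs

  sumL-lookup : ∀ (f : A → Bool) xs → sum (λ k → f (lookup xs k)) ≡ sumL f xs
  sumL-lookup f []       = refl
  sumL-lookup f (x ∷ xs) = cong (f x xor_) (sumL-lookup f xs)

  sumL-toList : ∀ {n} (f : A → Bool) (v : Vec A n) → sumL f (Vec.toList v) ≡ sum (λ i → f (Vec.lookup v i))
  sumL-toList f Vec.[]       = refl
  sumL-toList f (x Vec.∷ v) = cong (f x xor_) (sumL-toList f v)

  sumL-unique : ∀ (t h : A → Bool) {xs x} → AllPairs (λ y z → t y ∧ t z ≡ false) xs →
    x ∈ xs → t x ≡ true → sumL (λ y → t y ∧ h y) xs ≡ h x
  sumL-unique t h {y ∷ xs} (y-excl ∷ excl) (here refl) ty = begin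
    t y ∧ h y xor sumL (λ z → t z ∧ h z) xs     ≡⟨ cong₂ _xor_ (cong (_∧ h y) ty)
                                                           (sumL-cong (All.map vanish y-excl)) ⟩
    h y xor sumL (λ _ → false) xs               ≡⟨ cong (h y xor_) (sumL-zero xs) ⟩
    h y xor false                               ≡⟨ xor-identityʳ (h y) ⟩
    h y                                         ∎
    where
    vanish : ∀ {z} → t y ∧ t z ≡ false → t z ∧ h z ≡ false
    vanish {z} tytz rewrite ty | tytz = refl
  sumL-unique t h {y ∷ xs} (y-excl ∷ excl) (there x∈xs) tx =
    trans (cong (_xor sumL (λ z → t z ∧ h z) xs) head-vanishes) (sumL-unique t h excl x∈xs tx)
    where
    head-vanishes : t y ∧ h y ≡ false
    head-vanishes with t y | All.lookup y-excl x∈xs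
    ... | false | _ = refl
    ... | true  | txfalse with () ← trans (sym tx) txfalse

  ⊗-assoc : ∀ {n} (A B C : Mat₂ n) i j → (A ⊗ (B ⊗ C)) i j ≡ ((A ⊗ B) ⊗ C) i j
  ⊗-assoc A B C i j = begin
    sum (λ k → A i k ∧ sum (λ l → B k l ∧ C l j))    ≡⟨ sum-cong-≗ (λ k → ∑-∧ˡ (A i k) (λ l → B k l ∧ C l j)) ⟨
    sum (λ k → sum (λ l → A i k ∧ (B k l ∧ C l j)))  ≡⟨ ∑-comm (λ k l → A i k ∧ (B k l ∧ C l j)) ⟩
    sum (λ l → sum (λ k → A i k ∧ (B k l ∧ C l j)))  ≡⟨ sum-cong-≗ reassociate ⟩
    sum (λ l → sum (λ k → A i k ∧ B k l) ∧ C l j)    ∎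
    where
    reassociate : ∀ l → sum (λ k → A i k ∧ (B k l ∧ C l j)) ≡ sum (λ k → A i k ∧ B k l) ∧ C l j
    reassociate l = trans (sum-cong-≗ (λ k → sym (∧-assoc (A i k) (B k l) (C l j))))
                          (∑-∧ʳ (C l j) (λ k → A i k ∧ B k l))

module FieldFacts {q : ℕ} (F : FiniteField q) where

  open import Data.Bool using (Bool; true; false; _xor_; _∧_)
  open import Data.Bool.Properties using (xor-same; ∧-identityʳ; xor-identityʳ)
  open import Data.Fin as Fin using (Fin)
  open import Data.Fin.Properties as Fin using (<-cmp)
  import Data.Fin.Permutation as Perm
  open import Data.Vec as Vec using (Vec)
  open import Data.Product using (_,_; proj₁; proj₂)
  open import Data.List.Relation.Unary.All using (All; []; _∷_)
  open import Data.List.Relation.Unary.AllPairs using (AllPairs; []; _∷_)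
  open import Data.List.Membership.Propositional using (_∈_)
  open import Data.Vec.Membership.Propositional.Properties using (∈-lookup; ∈-toList⁺)
  open import Function using (_∘_)
  open import Relation.Nullary using (yes; no; does; contradiction)
  open import Relation.Nullary.Decidable using (⌊_⌋; dec-true; dec-false; isYes≗does)
  open import Relation.Binary.Definitions using (tri<; tri≈; tri>)
  import Relation.Binary.PropositionalEquality as ≡
  open ≡ using (_≢_)
  open F₂Sums

  open FiniteField F public
  open import Relation.Binary.Reasoning.Setoid setoid
  open import Algebra.Properties.Ring ring using (-‿distribˡ-*; -0#≈0#; -‿involutive)
  open import Algebra.Properties.Group +-group
    using (identityʳ-unique; inverseʳ-unique; x∙y⁻¹≈ε⇒x≈y; x≈y⇒x∙y⁻¹≈ε)
  open IntegerCoefficients commRing using (solve; _:=_; _:+_; _:*_; _:-_; :-_)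

  infix 4 _≈ᵇ_
  _≈ᵇ_ : Carrier → Carrier → Bool
  x ≈ᵇ y = ⌊ x ≟ y ⌋

  ≈⇒≈ᵇ : ∀ {x y} → x ≈ y → (x ≈ᵇ y) ≡ true
  ≈⇒≈ᵇ {x} {y} x≈y = ≡.trans (isYes≗does (x ≟ y)) (dec-true (x ≟ y) x≈y)

  ≉⇒≈ᵇ : ∀ {x y} → ¬ x ≈ y → (x ≈ᵇ y) ≡ false
  ≉⇒≈ᵇ {x} {y} x≉y = ≡.trans (isYes≗does (x ≟ y)) (dec-false (x ≟ y) x≉y)

  ≈ᵇ⇒≈ : ∀ {x y} → (x ≈ᵇ y) ≡ true → x ≈ y
  ≈ᵇ⇒≈ {x} {y} _ with x ≟ y
  ... | yes x≈y = x≈y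

  ≈ᵇ-equiv : ∀ {x y x′ y′} → (x ≈ y → x′ ≈ y′) → (x′ ≈ y′ → x ≈ y) → (x ≈ᵇ y) ≡ (x′ ≈ᵇ y′)
  ≈ᵇ-equiv {x} {y} to from with x ≟ y
  ... | yes x≈y = ≡.sym (≈⇒≈ᵇ (to x≈y))
  ... | no  x≉y = ≡.sym (≉⇒≈ᵇ (x≉y ∘ from))

  ≈ᵇ-cong : ∀ {x x′ y y′} → x ≈ x′ → y ≈ y′ → (x ≈ᵇ y) ≡ (x′ ≈ᵇ y′)
  ≈ᵇ-cong x≈x′ y≈y′ =
    ≈ᵇ-equiv (λ x≈y → trans (sym x≈x′) (trans x≈y y≈y′))
             (λ x′≈y′ → trans x≈x′ (trans x′≈y′ (sym y≈y′)))

  inv : ∀ x → ¬ x ≈ 0# → Carrier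
  inv x x≉0 = proj₁ (inverse x x≉0)

  *-inv : ∀ x (x≉0 : ¬ x ≈ 0#) → x * inv x x≉0 ≈ 1#
  *-inv x x≉0 = proj₂ (inverse x x≉0)

  solve-linear : ∀ {w a k} (w≉0 : ¬ w ≈ 0#) → w * a ≈ k → a ≈ k * inv w w≉0
  solve-linear {w} {a} {k} w≉0 wa≈k = begin
    a                       ≈⟨ *-identityʳ a ⟨
    a * 1#                  ≈⟨ *-congˡ (*-inv w w≉0) ⟨
    a * (w * inv w w≉0)     ≈⟨ *-assoc a w _ ⟨
    (a * w) * inv w w≉0     ≈⟨ *-congʳ (trans (*-comm a w) wa≈k) ⟩
    k * inv w w≉0           ∎

  xy≈0⇒y≈0 : ∀ {x y} → ¬ x ≈ 0# → x * y ≈ 0# → y ≈ 0#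
  xy≈0⇒y≈0 {x} {y} x≉0 xy≈0 = trans (solve-linear x≉0 xy≈0) (zeroˡ _)

  y≈0⇒xy≈0 : ∀ {x y} → y ≈ 0# → x * y ≈ 0#
  y≈0⇒xy≈0 {x} y≈0 = trans (*-congˡ y≈0) (zeroʳ x)

  x≈0⇒xy≈0 : ∀ {x y} → x ≈ 0# → x * y ≈ 0#
  x≈0⇒xy≈0 {y = y} x≈0 = trans (*-congʳ x≈0) (zeroˡ y)

  inv-≉0 : ∀ {x} (x≉0 : ¬ x ≈ 0#) → ¬ inv x x≉0 ≈ 0#
  inv-≉0 {x} x≉0 i≈0 = 1≉0 (trans (sym (*-inv x x≉0)) (y≈0⇒xy≈0 i≈0))

  -x≈0⇒x≈0 : ∀ {x} → - x ≈ 0# → x ≈ 0#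
  -x≈0⇒x≈0 {x} -x≈0 = trans (sym (-‿involutive x)) (trans (-‿cong -x≈0) -0#≈0#)

  ≈ᵇ0-scale : ∀ {c d x y} → ¬ c ≈ 0# → ¬ d ≈ 0# → c * x ≈ d * y → (x ≈ᵇ 0#) ≡ (y ≈ᵇ 0#)
  ≈ᵇ0-scale {c} {d} c≉0 d≉0 cx≈dy =
    ≈ᵇ-equiv (λ x≈0 → xy≈0⇒y≈0 d≉0 (trans (sym cx≈dy) (trans (*-congˡ x≈0) (zeroʳ c))))
             (λ y≈0 → xy≈0⇒y≈0 c≉0 (trans cx≈dy (trans (*-congˡ y≈0) (zeroʳ d))))

  *-≉0 : ∀ {x y} → ¬ x ≈ 0# → ¬ y ≈ 0# → ¬ x * y ≈ 0#
  *-≉0 x≉0 y≉0 xy≈0 = y≉0 (xy≈0⇒y≈0 x≉0 xy≈0)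

  ∑F : (Carrier → Bool) → Bool
  ∑F g = sum (λ i → g (Vec.lookup elems i))

  Respects≈ : (Carrier → Bool) → Set
  Respects≈ g = ∀ {x y} → x ≈ y → g x ≡ g y

  ∑F-cong : ∀ {f g : Carrier → Bool} → (∀ x → f x ≡ g x) → ∑F f ≡ ∑F g
  ∑F-cong f≗g = sum-cong-≗ (f≗g ∘ Vec.lookup elems)

  index : Carrier → Fin q
  index x = proj₁ (complete x)

  canonical : Carrier → Carrier
  canonical x = Vec.lookup elems (index x)

  canonical-≈ : ∀ x → canonical x ≈ x
  canonical-≈ x = sym (proj₂ (complete x))

  ∈-elements : ∀ x → canonical x ∈ Vec.toList elems
  ∈-elements x = ∈-toList⁺ (∈-lookup (index x) elems)

  index-cong : ∀ {x y} → x ≈ y → index x ≡ index y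
  index-cong {x} {y} x≈y = distinct _ _ (trans (canonical-≈ x) (trans x≈y (sym (canonical-≈ y))))

  index-injective : ∀ {x y} → index x ≡ index y → x ≈ y
  index-injective {x} {y} i≡j =
    trans (sym (canonical-≈ x)) (trans (reflexive (≡.cong (Vec.lookup elems) i≡j)) (canonical-≈ y))

  index-lookup : ∀ i → index (Vec.lookup elems i) ≡ i
  index-lookup i = distinct _ _ (canonical-≈ _)

  ∑F-delta : ∀ c (g : Carrier → Bool) → Respects≈ g → ∑F (λ a → (a ≈ᵇ c) ∧ g a) ≡ g c
  ∑F-delta c g g-resp = ≡.trans (∑-single _ (index c) off-c) on-c
    where
    on-c : ((Vec.lookup elems (index c) ≈ᵇ c) ∧ g (Vec.lookup elems (index c))) ≡ g c
    on-c = ≡.cong₂ _∧_ (≈⇒≈ᵇ (canonical-≈ c)) (g-resp (canonical-≈ c))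
    off-c : ∀ i → i ≢ index c → ((Vec.lookup elems i ≈ᵇ c) ∧ g (Vec.lookup elems i)) ≡ false
    off-c i i≢c with Vec.lookup elems i ≟ c
    ... | yes eᵢ≈c = contradiction (≡.trans (≡.sym (index-lookup i)) (index-cong eᵢ≈c)) i≢c
    ... | no  _    = ≡.refl

  ∑F-zero : ∀ {h} → (∀ x → h x ≡ false) → ∑F h ≡ false
  ∑F-zero h≗0 = ≡.trans (∑F-cong h≗0) (sum-replicate-zero q)

  ∑F-indicator : ∀ c → ∑F (_≈ᵇ c) ≡ true
  ∑F-indicator c = ≡.trans (∑F-cong (λ a → ≡.sym (∧-identityʳ (a ≈ᵇ c)))) (∑F-delta c _ (λ _ → ≡.refl))

  ∑F-reindex : (σ : Carrier → Carrier) → (∀ {x y} → x ≈ y → σ x ≈ σ y) → (∀ x → σ (σ x) ≈ x) →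
    (g : Carrier → Bool) → Respects≈ g → ∑F (g ∘ σ) ≡ ∑F g
  ∑F-reindex σ σ-cong σ-invol g g-resp =
    ≡.trans (∑F-cong (λ a → g-resp (sym (canonical-≈ (σ a)))))
            (≡.sym (sum-permute (g ∘ Vec.lookup elems) π))
    where
    σ̂ : Fin q → Fin q
    σ̂ i = index (σ (Vec.lookup elems i))
    σ̂-invol : ∀ i → σ̂ (σ̂ i) ≡ i
    σ̂-invol i = ≡.trans (index-cong (trans (σ-cong (canonical-≈ _)) (σ-invol _))) (index-lookup i)
    π : Perm.Permutation q q
    π = Perm.permutation σ̂ σ̂ σ̂-invol σ̂-invol

  -- If 1 + 1 = 0, then a ↦ a + 1 pairs off the elements of F, so q would be even.
  1+1≉0 : q % 2 ≡ 1 → ¬ 1# + 1# ≈ 0#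
  1+1≉0 q-odd 2≈0 = contradiction (≡.trans (≡.sym (∑-true-odd q q-odd)) pairs-cancel) λ ()
    where
    shift : Carrier → Carrier
    shift a = a + 1#
    shift-invol : ∀ a → shift (shift a) ≈ a
    shift-invol a = trans (+-assoc a 1# 1#) (trans (+-congˡ 2≈0) (+-identityʳ a))
    -- Exactly one element of each pair {a, a + 1} has the smaller index.
    first : Carrier → Bool
    first a = does (index a Fin.<? index (shift a))
    first-xor : ∀ a → (first a xor first (shift a)) ≡ true
    first-xor a
      rewrite index-cong (shift-invol a)
      with <-cmp (index a) (index (shift a))
    ... | tri< i<j _ j≮i = ≡.cong₂ _xor_ (dec-true (_ Fin.<? _) i<j) (dec-false (_ Fin.<? _) j≮i)
    ... | tri> i≮j _ j<i = ≡.cong₂ _xor_ (dec-false (_ Fin.<? _) i≮j) (dec-true (_ Fin.<? _) j<i)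
    ... | tri≈ _ i≡j _   = contradiction (identityʳ-unique a 1# (sym (index-injective i≡j))) 1≉0
    pairs-cancel : ∑F (λ _ → true) ≡ false
    pairs-cancel = ≡.trans (∑F-cong (λ a → ≡.sym (first-xor a)))
      (≡.trans (∑-distrib-+ (first ∘ Vec.lookup elems) _)
      (≡.trans (≡.cong (∑F first xor_) (∑F-reindex shift +-congʳ shift-invol first
                  (λ x≈y → ≡.cong₂ (λ i j → does (i Fin.<? j)) (index-cong x≈y) (index-cong (+-congʳ x≈y)))))
               (xor-same (∑F first))))

  elements-distinct : AllPairs (λ a b → ¬ a ≈ b) (Vec.toList elems)
  elements-distinct = toList-distinct elems distinct
    where
    toList-distinct : ∀ {n} (v : Vec Carrier n) → (∀ i j → Vec.lookup v i ≈ Vec.lookup v j → i ≡ j) →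
      AllPairs (λ a b → ¬ a ≈ b) (Vec.toList v)
    toList-distinct Vec.[]       _        = []
    toList-distinct (x Vec.∷ v) injective =
      head-distinct v (λ k x≈vₖ → contradiction (injective Fin.zero (Fin.suc k) x≈vₖ) λ ())
      ∷ toList-distinct v (λ i j vᵢ≈vⱼ → Fin.suc-injective (injective (Fin.suc i) (Fin.suc j) vᵢ≈vⱼ))
      where
      head-distinct : ∀ {m} (w : Vec Carrier m) → (∀ k → ¬ x ≈ Vec.lookup w k) →
        All (λ b → ¬ x ≈ b) (Vec.toList w)
      head-distinct Vec.[]       _    = []
      head-distinct (y Vec.∷ w) x≉w = x≉w Fin.zero ∷ head-distinct w (x≉w ∘ Fin.suc)


  ≈ᵇ0-linear : ∀ {k} (k≉0 : ¬ k ≈ 0#) c t → (c + k * t ≈ᵇ 0#) ≡ (t ≈ᵇ - (c * inv k k≉0))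
  ≈ᵇ0-linear {k} k≉0 c t = ≈ᵇ-equiv root root⁻¹
    where
    i = inv k k≉0
    root : c + k * t ≈ 0# → t ≈ - (c * i)
    root c+kt≈0 = trans (solve-linear k≉0 (inverseʳ-unique c (k * t) c+kt≈0)) (sym (-‿distribˡ-* c i))
    root⁻¹ : t ≈ - (c * i) → c + k * t ≈ 0#
    root⁻¹ t≈r = begin
      c + k * t              ≈⟨ +-congˡ (*-congˡ t≈r) ⟩
      c + k * - (c * i)      ≈⟨ solve 3 (λ c k i → c :+ k :* (:- (c :* i)) := c :- c :* (k :* i)) refl c k i ⟩
      c - c * (k * i)        ≈⟨ +-congˡ (-‿cong (trans (*-congˡ (*-inv k k≉0)) (*-identityʳ c))) ⟩
      c - c                  ≈⟨ -‿inverseʳ c ⟩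
      0#                     ∎

  ∑F-linear : ∀ {k} (k≉0 : ¬ k ≈ 0#) c (g : Carrier → Bool) → Respects≈ g →
    ∑F (λ t → (c + k * t ≈ᵇ 0#) ∧ g t) ≡ g (- (c * inv k k≉0))
  ∑F-linear k≉0 c g g-resp =
    ≡.trans (∑F-cong (λ t → ≡.cong (_∧ g t) (≈ᵇ0-linear k≉0 c t))) (∑F-delta _ g g-resp)

  quadratic : Carrier → Carrier → Carrier → Carrier → Carrier
  quadratic a b c t = a * (t * t) + (b + b) * t + c

  module _ (q-odd : q % 2 ≡ 1) where

    x+x≈0⇒x≈0 : ∀ {x} → x + x ≈ 0# → x ≈ 0#
    x+x≈0⇒x≈0 {x} x+x≈0 = xy≈0⇒y≈0 (1+1≉0 q-odd) (begin
      (1# + 1#) * x     ≈⟨ distribʳ x 1# 1# ⟩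
      1# * x + 1# * x   ≈⟨ +-cong (*-identityˡ x) (*-identityˡ x) ⟩
      x + x             ≈⟨ x+x≈0 ⟩
      0#                ∎)

    -- With a second root r′ = -(r + 2b/a), a t² + 2 b t + c = a (t - r) (t - r′).
    roots-cancel : ∀ {a b c r} → ¬ a ≈ 0# → ¬ a * c - b * b ≈ 0# → quadratic a b c r ≈ 0# →
      ∑F (λ t → quadratic a b c t ≈ᵇ 0#) ≡ false
    roots-cancel {a} {b} {c} {r} a≉0 disc≉0 fr≈0 =
      ≡.trans (∑F-cong roots)
        (≡.trans (∑-distrib-+ (λ i → Vec.lookup elems i ≈ᵇ r) _)
          (≡.cong₂ _xor_ (∑F-indicator r) (∑F-indicator r′)))
      where
      f = quadratic a b c
      d = b + b
      i = inv a a≉0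
      r′ = - (r + d * i)
      sum-of-roots : ∀ t → a * (t + r) + d ≈ a * (t - r′)
      sum-of-roots t = sym (begin
        a * (t - r′)                ≈⟨ solve 5 (λ a t r d i → a :* (t :- (:- (r :+ d :* i)))
                                                  := a :* (t :+ r) :+ d :* (a :* i)) refl a t r d i ⟩
        a * (t + r) + d * (a * i)   ≈⟨ +-congˡ (trans (*-congˡ (*-inv a a≉0)) (*-identityʳ d)) ⟩
        a * (t + r) + d             ∎)
      factor : ∀ t → f t ≈ (t - r) * (a * (t - r′))
      factor t = begin
        f t                           ≈⟨ trans (+-congˡ -0#≈0#) (+-identityʳ (f t)) ⟨
        f t - 0#                      ≈⟨ +-congˡ (-‿cong fr≈0) ⟨
        f t - f r                     ≈⟨ solve 5 (λ a d c t r →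
                                                    a :* (t :* t) :+ d :* t :+ c :- (a :* (r :* r) :+ d :* r :+ c)
                                                    := (t :- r) :* (a :* (t :+ r) :+ d)) refl a d c t r ⟩
        (t - r) * (a * (t + r) + d)   ≈⟨ *-congˡ (sum-of-roots t) ⟩
        (t - r) * (a * (t - r′))      ∎
      r≉r′ : ¬ r ≈ r′
      r≉r′ r≈r′ = disc≉0 (begin
        a * c - b * b                          ≈⟨ solve 4 (λ a b c r → a :* c :- b :* b
                                                    := a :* (a :* (r :* r) :+ (b :+ b) :* r :+ c)
                                                       :- (a :* r :+ b) :* (a :* r :+ b)) refl a b c r ⟩
        a * f r - (a * r + b) * (a * r + b)    ≈⟨ +-cong (y≈0⇒xy≈0 fr≈0) (-‿cong (x≈0⇒xy≈0 ar+b≈0)) ⟩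
        0# - 0#                                ≈⟨ -‿inverseʳ 0# ⟩
        0#                                     ∎)
        where
        ar+b≈0 : a * r + b ≈ 0#
        ar+b≈0 = x+x≈0⇒x≈0 (begin
          (a * r + b) + (a * r + b)   ≈⟨ solve 3 (λ a r b → a :* r :+ b :+ (a :* r :+ b) := a :* (r :+ r) :+ (b :+ b))
                                           refl a r b ⟩
          a * (r + r) + d             ≈⟨ sum-of-roots r ⟩
          a * (r - r′)                ≈⟨ y≈0⇒xy≈0 (trans (+-congˡ (-‿cong (sym r≈r′))) (-‿inverseʳ r)) ⟩
          0#                          ∎)
      roots : ∀ t → (f t ≈ᵇ 0#) ≡ ((t ≈ᵇ r) xor (t ≈ᵇ r′))
      roots t with t ≟ r | t ≟ r′
      ... | yes t≈r | yes t≈r′ = contradiction (trans (sym t≈r) t≈r′) r≉r′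
      ... | yes t≈r | no  _    = ≈⇒≈ᵇ (trans (factor t) (x≈0⇒xy≈0 (x≈y⇒x∙y⁻¹≈ε t≈r)))
      ... | no  _   | yes t≈r′ = ≈⇒≈ᵇ (trans (factor t) (y≈0⇒xy≈0 (y≈0⇒xy≈0 (x≈y⇒x∙y⁻¹≈ε t≈r′))))
      ... | no  t≉r | no  t≉r′ = ≉⇒≈ᵇ (λ ft≈0 → product≉0 (trans (sym (factor t)) ft≈0))
        where
        product≉0 = *-≉0 (t≉r ∘ x∙y⁻¹≈ε⇒x≈y t r) (*-≉0 a≉0 (t≉r′ ∘ x∙y⁻¹≈ε⇒x≈y t r′))

    quadratic-roots-even : ∀ a b c → ¬ a * c - b * b ≈ 0# →
      (∑F (λ t → quadratic a b c t ≈ᵇ 0#) xor (a ≈ᵇ 0#)) ≡ false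
    quadratic-roots-even a b c disc≉0 with a ≟ 0#
    ... | yes a≈0 = ≡.cong (_xor true) (≡.trans (∑F-cong linear) (∑F-indicator _))
      where
      2b≉0 : ¬ b + b ≈ 0#
      2b≉0 2b≈0 = disc≉0 (begin
        a * c - b * b     ≈⟨ +-cong (x≈0⇒xy≈0 a≈0) (-‿cong (x≈0⇒xy≈0 (x+x≈0⇒x≈0 2b≈0))) ⟩
        0# - 0#           ≈⟨ -‿inverseʳ 0# ⟩
        0#                ∎)
      linear : ∀ t → (quadratic a b c t ≈ᵇ 0#) ≡ (t ≈ᵇ - (c * inv (b + b) 2b≉0))
      linear t = ≡.trans (≈ᵇ-cong (trans (+-congʳ (trans (+-congʳ (x≈0⇒xy≈0 a≈0)) (+-identityˡ _))) (+-comm _ c)) refl)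
                         (≈ᵇ0-linear 2b≉0 c t)
    ... | no a≉0 with Fin.any? (λ i → quadratic a b c (Vec.lookup elems i) ≟ 0#)
    ...   | no  no-root    = ≡.trans (xor-identityʳ _) (≡.trans (sum-cong-≗ (λ i → ≉⇒≈ᵇ (no-root ∘ (i ,_))))
                                                                (sum-replicate-zero q))
    ...   | yes (_ , fr≈0) = ≡.trans (xor-identityʳ _) (roots-cancel a≉0 disc≉0 fr≈0)

module Plane {q : ℕ} (F : FiniteField q) (α : FiniteField.Carrier F)
             (α≉0 : ¬ FiniteField._≈_ F α (FiniteField.0# F)) where

  open import Data.Bool using (Bool; true; false; _xor_; _∧_; not)
  open import Data.Bool.Properties using (xor-identityʳ; ∧-comm)
  open import Data.List using (List; map; concatMap)
  import Data.Vec as Vec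
  open import Data.List.Membership.Propositional using (_∈_; lose)
  open import Data.List.Membership.Propositional.Properties using (∈-++⁺ˡ; ∈-++⁺ʳ; ∈-concatMap⁺; ∈-map⁺)
  open import Data.List.Relation.Unary.Any using (here)
  open import Data.List.Relation.Unary.All as All using (All; []; _∷_)
  import Data.List.Relation.Unary.All.Properties as All
  open import Data.List.Relation.Unary.AllPairs as AllPairs using (AllPairs; []; _∷_)
  import Data.List.Relation.Unary.AllPairs.Properties as AllPairs
  open import Data.Product using (Σ-syntax; _,_; proj₁; proj₂)
  open import Data.Product.Relation.Binary.Pointwise.NonDependent using (Pointwise; ×-setoid)
  open import Function using (_∘_)
  open import Relation.Nullary using (Dec; yes; no; contradiction)
  open import Relation.Nullary.Decidable using (⌊_⌋; dec-true; dec-false; isYes≗does; _×-dec_)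
  import Relation.Binary.PropositionalEquality as ≡
  open import Relation.Binary.Bundles using (Setoid)

  open F₂Sums
  open FieldFacts F
  open PG2 F α
  open IntegerCoefficients commRing using (solve; _:=_; _:+_; _:*_; _:-_; :-_; con; Polynomial)
  open import Relation.Binary.Reasoning.Setoid setoid
  open import Algebra.Properties.Ring ring using (-0#≈0#)
  open import Algebra.Properties.Group +-group using (x∙y⁻¹≈ε⇒x≈y)
  import Data.Integer as ℤ

  private
    :0 : ∀ {n} → Polynomial n
    :0 = con (ℤ.+ 0)

  infix  4 _≈₃_ _∥_ _∥ᵇ_ _⊥ᵇ_
  infixl 6 _+₃_
  infixr 7 _•_

  _≈₃_ : Vec3 → Vec3 → Set
  _≈₃_ = Pointwise _≈_ (Pointwise _≈_ _≈_)

  open Setoid (×-setoid setoid (×-setoid setoid setoid)) public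
    using () renaming (refl to ≈₃-refl; sym to ≈₃-sym; trans to ≈₃-trans)

  Zero₃ NonZero₃ : Vec3 → Set
  Zero₃ X    = X ≈₃ (0# , 0# , 0#)
  NonZero₃ X = ¬ Zero₃ X

  zero₃? : ∀ X → Dec (Zero₃ X)
  zero₃? (x₀ , x₁ , x₂) = (x₀ ≟ 0#) ×-dec (x₁ ≟ 0#) ×-dec (x₂ ≟ 0#)

  _•_ : Carrier → Vec3 → Vec3
  c • (x₀ , x₁ , x₂) = c * x₀ , c * x₁ , c * x₂

  _+₃_ : Vec3 → Vec3 → Vec3
  (x₀ , x₁ , x₂) +₃ (y₀ , y₁ , y₂) = x₀ + y₀ , x₁ + y₁ , x₂ + y₂

  _×₃_ : Vec3 → Vec3 → Vec3
  (x₀ , x₁ , x₂) ×₃ (y₀ , y₁ , y₂) = x₁ * y₂ - x₂ * y₁ , x₂ * y₀ - x₀ * y₂ , x₀ * y₁ - x₁ * y₀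

  dot : Vec3 → Vec3 → Carrier
  dot (x₀ , x₁ , x₂) (y₀ , y₁ , y₂) = x₀ * y₀ + x₁ * y₁ + x₂ * y₂

  -- The coordinates of the line X^⊥: ⟨ X , Y ⟩ = dot (G X) Y.
  G : Vec3 → Vec3
  G (x₀ , x₁ , x₂) = x₀ , - x₁ , α * x₂

  ×₃-cong : ∀ {X X′ Y Y′} → X ≈₃ X′ → Y ≈₃ Y′ → X ×₃ Y ≈₃ X′ ×₃ Y′
  ×₃-cong (x₀ , x₁ , x₂) (y₀ , y₁ , y₂) =
    +-cong (*-cong x₁ y₂) (-‿cong (*-cong x₂ y₁)) ,
    +-cong (*-cong x₂ y₀) (-‿cong (*-cong x₀ y₂)) ,
    +-cong (*-cong x₀ y₁) (-‿cong (*-cong x₁ y₀))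

  dot-congʳ : ∀ X {Y Y′} → Y ≈₃ Y′ → dot X Y ≈ dot X Y′
  dot-congʳ X (y₀ , y₁ , y₂) = +-cong (+-cong (*-congˡ y₀) (*-congˡ y₁)) (*-congˡ y₂)

  ⟨⟩-cong : ∀ {X X′ Y Y′} → X ≈₃ X′ → Y ≈₃ Y′ → ⟨ X , Y ⟩ ≈ ⟨ X′ , Y′ ⟩
  ⟨⟩-cong (x₀ , x₁ , x₂) (y₀ , y₁ , y₂) =
    +-cong (+-cong (*-cong x₀ y₀) (-‿cong (*-cong x₁ y₁))) (*-congˡ (*-cong x₂ y₂))

  Zero₃-• : ∀ c {X} → Zero₃ X → Zero₃ (c • X)
  Zero₃-• c (x₀ , x₁ , x₂) = y≈0⇒xy≈0 x₀ , y≈0⇒xy≈0 x₁ , y≈0⇒xy≈0 x₂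

  •-Zero₃ : ∀ {c X} → ¬ c ≈ 0# → Zero₃ (c • X) → Zero₃ X
  •-Zero₃ c≉0 (x₀ , x₁ , x₂) = xy≈0⇒y≈0 c≉0 x₀ , xy≈0⇒y≈0 c≉0 x₁ , xy≈0⇒y≈0 c≉0 x₂

  ⟨⟩-sym : ∀ X Y → ⟨ X , Y ⟩ ≈ ⟨ Y , X ⟩
  ⟨⟩-sym (x₀ , x₁ , x₂) (y₀ , y₁ , y₂) = solve 7 (λ a x₀ x₁ x₂ y₀ y₁ y₂ →
      x₀ :* y₀ :- x₁ :* y₁ :+ a :* (x₂ :* y₂) := y₀ :* x₀ :- y₁ :* x₁ :+ a :* (y₂ :* x₂))
    refl α x₀ x₁ x₂ y₀ y₁ y₂

  ⟨•⟩ : ∀ c X Y → ⟨ c • X , Y ⟩ ≈ c * ⟨ X , Y ⟩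
  ⟨•⟩ c (x₀ , x₁ , x₂) (y₀ , y₁ , y₂) = solve 8 (λ a c x₀ x₁ x₂ y₀ y₁ y₂ →
      c :* x₀ :* y₀ :- c :* x₁ :* y₁ :+ a :* (c :* x₂ :* y₂) := c :* (x₀ :* y₀ :- x₁ :* y₁ :+ a :* (x₂ :* y₂)))
    refl α c x₀ x₁ x₂ y₀ y₁ y₂

  Q-• : ∀ c X → Q (c • X) ≈ (c * c) * Q X
  Q-• c X = begin
    ⟨ c • X , c • X ⟩    ≈⟨ ⟨•⟩ c X (c • X) ⟩
    c * ⟨ X , c • X ⟩    ≈⟨ *-congˡ (trans (⟨⟩-sym X (c • X)) (⟨•⟩ c X X)) ⟩
    c * (c * Q X)        ≈⟨ *-assoc c c (Q X) ⟨
    (c * c) * Q X        ∎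

  ⟨⟩≈dot-G : ∀ X Y → ⟨ X , Y ⟩ ≈ dot (G X) Y
  ⟨⟩≈dot-G (x₀ , x₁ , x₂) (y₀ , y₁ , y₂) = solve 7 (λ a x₀ x₁ x₂ y₀ y₁ y₂ →
      x₀ :* y₀ :- x₁ :* y₁ :+ a :* (x₂ :* y₂) := x₀ :* y₀ :+ (:- x₁) :* y₁ :+ a :* x₂ :* y₂)
    refl α x₀ x₁ x₂ y₀ y₁ y₂

  dot-comm : ∀ X Y → dot X Y ≈ dot Y X
  dot-comm (x₀ , x₁ , x₂) (y₀ , y₁ , y₂) = +-cong (+-cong (*-comm x₀ y₀) (*-comm x₁ y₁)) (*-comm x₂ y₂)

  dot-• : ∀ c X Y → dot X (c • Y) ≈ c * dot X Y
  dot-• c (x₀ , x₁ , x₂) (y₀ , y₁ , y₂) = solve 7 (λ c x₀ x₁ x₂ y₀ y₁ y₂ →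
      x₀ :* (c :* y₀) :+ x₁ :* (c :* y₁) :+ x₂ :* (c :* y₂) := c :* (x₀ :* y₀ :+ x₁ :* y₁ :+ x₂ :* y₂))
    refl c x₀ x₁ x₂ y₀ y₁ y₂

  ×₃-self : ∀ X → Zero₃ (X ×₃ X)
  ×₃-self (x₀ , x₁ , x₂) = x*y-y*x x₁ x₂ , x*y-y*x x₂ x₀ , x*y-y*x x₀ x₁
    where
    x*y-y*x : ∀ x y → x * y - y * x ≈ 0#
    x*y-y*x x y = trans (+-congˡ (-‿cong (*-comm y x))) (-‿inverseʳ (x * y))

  ×₃-•ˡ : ∀ c X Y → (c • X) ×₃ Y ≈₃ c • (X ×₃ Y)
  ×₃-•ˡ c (x₀ , x₁ , x₂) (y₀ , y₁ , y₂) = scaled x₁ x₂ y₁ y₂ , scaled x₂ x₀ y₂ y₀ , scaled x₀ x₁ y₀ y₁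
    where
    scaled : ∀ x x′ y y′ → c * x * y′ - c * x′ * y ≈ c * (x * y′ - x′ * y)
    scaled = solve 5 (λ c x x′ y y′ → c :* x :* y′ :- c :* x′ :* y := c :* (x :* y′ :- x′ :* y)) refl c

  ×₃-anticomm-Zero₃ : ∀ X Y → Zero₃ (X ×₃ Y) → Zero₃ (Y ×₃ X)
  ×₃-anticomm-Zero₃ (x₀ , x₁ , x₂) (y₀ , y₁ , y₂) (e₀ , e₁ , e₂) =
    swapped y₁ y₂ x₁ x₂ e₀ , swapped y₂ y₀ x₂ x₀ e₁ , swapped y₀ y₁ x₀ x₁ e₂
    where
    swapped : ∀ y y′ x x′ → x * y′ - x′ * y ≈ 0# → y * x′ - y′ * x ≈ 0#
    swapped y y′ x x′ e = begin
      y * x′ - y′ * x       ≈⟨ solve 4 (λ x x′ y y′ → y :* x′ :- y′ :* x := :- (x :* y′ :- x′ :* y)) refl x x′ y y′ ⟩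
      - (x * y′ - x′ * y)   ≈⟨ -‿cong e ⟩
      - 0#                  ≈⟨ -0#≈0# ⟩
      0#                    ∎

  ×₃-×₃ : ∀ l m S → (l ×₃ m) ×₃ S ≈₃ dot l S • m +₃ - dot m S • l
  ×₃-×₃ (l₀ , l₁ , l₂) (m₀ , m₁ , m₂) (s₀ , s₁ , s₂) =
    solve 9 (λ l₀ l₁ l₂ m₀ m₁ m₂ s₀ s₁ s₂ → (l₂ :* m₀ :- l₀ :* m₂) :* s₂ :- (l₀ :* m₁ :- l₁ :* m₀) :* s₁
       := (l₀ :* s₀ :+ l₁ :* s₁ :+ l₂ :* s₂) :* m₀ :+ :- (m₀ :* s₀ :+ m₁ :* s₁ :+ m₂ :* s₂) :* l₀)
      refl l₀ l₁ l₂ m₀ m₁ m₂ s₀ s₁ s₂ ,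
    solve 9 (λ l₀ l₁ l₂ m₀ m₁ m₂ s₀ s₁ s₂ → (l₀ :* m₁ :- l₁ :* m₀) :* s₀ :- (l₁ :* m₂ :- l₂ :* m₁) :* s₂
       := (l₀ :* s₀ :+ l₁ :* s₁ :+ l₂ :* s₂) :* m₁ :+ :- (m₀ :* s₀ :+ m₁ :* s₁ :+ m₂ :* s₂) :* l₁)
      refl l₀ l₁ l₂ m₀ m₁ m₂ s₀ s₁ s₂ ,
    solve 9 (λ l₀ l₁ l₂ m₀ m₁ m₂ s₀ s₁ s₂ → (l₁ :* m₂ :- l₂ :* m₁) :* s₁ :- (l₂ :* m₀ :- l₀ :* m₂) :* s₀
       := (l₀ :* s₀ :+ l₁ :* s₁ :+ l₂ :* s₂) :* m₂ :+ :- (m₀ :* s₀ :+ m₁ :* s₁ :+ m₂ :* s₂) :* l₂)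
      refl l₀ l₁ l₂ m₀ m₁ m₂ s₀ s₁ s₂

  dot-×₃ˡ : ∀ l m → dot l (l ×₃ m) ≈ 0#
  dot-×₃ˡ (l₀ , l₁ , l₂) (m₀ , m₁ , m₂) = solve 6 (λ l₀ l₁ l₂ m₀ m₁ m₂ →
      l₀ :* (l₁ :* m₂ :- l₂ :* m₁) :+ l₁ :* (l₂ :* m₀ :- l₀ :* m₂) :+ l₂ :* (l₀ :* m₁ :- l₁ :* m₀) := :0)
    refl l₀ l₁ l₂ m₀ m₁ m₂

  dot-×₃ʳ : ∀ l m → dot m (l ×₃ m) ≈ 0#
  dot-×₃ʳ (l₀ , l₁ , l₂) (m₀ , m₁ , m₂) = solve 6 (λ l₀ l₁ l₂ m₀ m₁ m₂ →
      m₀ :* (l₁ :* m₂ :- l₂ :* m₁) :+ m₁ :* (l₂ :* m₀ :- l₀ :* m₂) :+ m₂ :* (l₀ :* m₁ :- l₁ :* m₀) := :0)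
    refl l₀ l₁ l₂ m₀ m₁ m₂

  -- G X × G Y = (-α n₀ , α n₁ , - n₂) where n = X × Y.
  G×₃G-Zero₃ : ∀ X Y → Zero₃ (G X ×₃ G Y) → Zero₃ (X ×₃ Y)
  G×₃G-Zero₃ (x₀ , x₁ , x₂) (y₀ , y₁ , y₂) (e₀ , e₁ , e₂) =
    xy≈0⇒y≈0 (α≉0 ∘ -x≈0⇒x≈0)
      (trans (solve 5 (λ a x₁ x₂ y₁ y₂ → (:- a) :* (x₁ :* y₂ :- x₂ :* y₁) := (:- x₁) :* (a :* y₂) :- a :* x₂ :* (:- y₁))
               refl α x₁ x₂ y₁ y₂) e₀) ,
    xy≈0⇒y≈0 α≉0
      (trans (solve 5 (λ a x₀ x₂ y₀ y₂ → a :* (x₂ :* y₀ :- x₀ :* y₂) := a :* x₂ :* y₀ :- x₀ :* (a :* y₂))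
               refl α x₀ x₂ y₀ y₂) e₁) ,
    -x≈0⇒x≈0
      (trans (solve 4 (λ x₀ x₁ y₀ y₁ → :- (x₀ :* y₁ :- x₁ :* y₀) := x₀ :* (:- y₁) :- (:- x₁) :* y₀)
               refl x₀ x₁ y₀ y₁) e₂)

  G-NonZero₃ : ∀ {X} → NonZero₃ X → NonZero₃ (G X)
  G-NonZero₃ X≢0 (x₀ , x₁ , x₂) = X≢0 (x₀ , -x≈0⇒x≈0 x₁ , xy≈0⇒y≈0 α≉0 x₂)

  -- The quadratic form of the adjugate of the Gram matrix diag(1, -1, α) of Q.
  Q⋆ : Vec3 → Carrier
  Q⋆ (n₀ , n₁ , n₂) = - α * (n₀ * n₀) + α * (n₁ * n₁) - n₂ * n₂

  Q⋆-cong : ∀ {U V} → U ≈₃ V → Q⋆ U ≈ Q⋆ V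
  Q⋆-cong (u₀ , u₁ , u₂) = +-cong (+-cong (*-congˡ (*-cong u₀ u₀)) (*-congˡ (*-cong u₁ u₁))) (-‿cong (*-cong u₂ u₂))

  lagrange-identity : ∀ u v → Q v * Q u - ⟨ u , v ⟩ * ⟨ u , v ⟩ ≈ Q⋆ (u ×₃ v)
  lagrange-identity (u₀ , u₁ , u₂) (v₀ , v₁ , v₂) = solve 7 (λ a u₀ u₁ u₂ v₀ v₁ v₂ →
      (v₀ :* v₀ :- v₁ :* v₁ :+ a :* (v₂ :* v₂)) :* (u₀ :* u₀ :- u₁ :* u₁ :+ a :* (u₂ :* u₂))
        :- (u₀ :* v₀ :- u₁ :* v₁ :+ a :* (u₂ :* v₂)) :* (u₀ :* v₀ :- u₁ :* v₁ :+ a :* (u₂ :* v₂))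
      := (:- a) :* ((u₁ :* v₂ :- u₂ :* v₁) :* (u₁ :* v₂ :- u₂ :* v₁))
        :+ a :* ((u₂ :* v₀ :- u₀ :* v₂) :* (u₂ :* v₀ :- u₀ :* v₂))
        :- (u₀ :* v₁ :- u₁ :* v₀) :* (u₀ :* v₁ :- u₁ :* v₀))
    refl α u₀ u₁ u₂ v₀ v₁ v₂

  Q⋆-G : ∀ k P → Q⋆ (k • G P) ≈ (- α * (k * k)) * Q P
  Q⋆-G k (p₀ , p₁ , p₂) = solve 5 (λ a k p₀ p₁ p₂ →
      (:- a) :* (k :* p₀ :* (k :* p₀)) :+ a :* (k :* (:- p₁) :* (k :* (:- p₁))) :- k :* (a :* p₂) :* (k :* (a :* p₂))
      := (:- a) :* (k :* k) :* (p₀ :* p₀ :- p₁ :* p₁ :+ a :* (p₂ :* p₂)))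
    refl α k p₀ p₁ p₂

  Q-line : ∀ u v t → Q (u +₃ t • v) ≈ quadratic (Q v) ⟨ u , v ⟩ (Q u) t
  Q-line (u₀ , u₁ , u₂) (v₀ , v₁ , v₂) t = solve 8 (λ a u₀ u₁ u₂ v₀ v₁ v₂ t →
      (u₀ :+ t :* v₀) :* (u₀ :+ t :* v₀) :- (u₁ :+ t :* v₁) :* (u₁ :+ t :* v₁) :+ a :* ((u₂ :+ t :* v₂) :* (u₂ :+ t :* v₂))
      := (v₀ :* v₀ :- v₁ :* v₁ :+ a :* (v₂ :* v₂)) :* (t :* t)
         :+ ((u₀ :* v₀ :- u₁ :* v₁ :+ a :* (u₂ :* v₂)) :+ (u₀ :* v₀ :- u₁ :* v₁ :+ a :* (u₂ :* v₂))) :* t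
         :+ (u₀ :* u₀ :- u₁ :* u₁ :+ a :* (u₂ :* u₂)))
    refl α u₀ u₁ u₂ v₀ v₁ v₂ t

  _∥_ : Vec3 → Vec3 → Set
  X ∥ Y = Zero₃ (X ×₃ Y)

  _∥ᵇ_ : Vec3 → Vec3 → Bool
  X ∥ᵇ Y = ⌊ zero₃? (X ×₃ Y) ⌋

  _⊥ᵇ_ : Vec3 → Vec3 → Bool
  X ⊥ᵇ Y = ⟨ X , Y ⟩ ≈ᵇ 0#

  isotropicᵇ anisotropicᵇ : Vec3 → Bool
  isotropicᵇ X   = Q X ≈ᵇ 0#
  anisotropicᵇ X = not (isotropicᵇ X)

  ∥⇒∥ᵇ : ∀ {X Y} → X ∥ Y → (X ∥ᵇ Y) ≡ true
  ∥⇒∥ᵇ {X} {Y} = ≡.trans (isYes≗does (zero₃? (X ×₃ Y))) ∘ dec-true (zero₃? (X ×₃ Y))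

  ∦⇒∥ᵇ : ∀ {X Y} → ¬ X ∥ Y → (X ∥ᵇ Y) ≡ false
  ∦⇒∥ᵇ {X} {Y} = ≡.trans (isYes≗does (zero₃? (X ×₃ Y))) ∘ dec-false (zero₃? (X ×₃ Y))

  ∥ᵇ⇒∥ : ∀ {X Y} → (X ∥ᵇ Y) ≡ true → X ∥ Y
  ∥ᵇ⇒∥ {X} {Y} _ with zero₃? (X ×₃ Y)
  ... | yes X∥Y = X∥Y

  ∥-refl : ∀ X → X ∥ X
  ∥-refl = ×₃-self

  ∥-sym : ∀ {X Y} → X ∥ Y → Y ∥ X
  ∥-sym {X} {Y} = ×₃-anticomm-Zero₃ X Y

  •-∥ : ∀ c X → c • X ∥ X
  •-∥ c X = ≈₃-trans (×₃-•ˡ c X X) (Zero₃-• c (×₃-self X))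

  data Pivot : Vec3 → Set where
    pivot₀ : ∀ {x₀ x₁ x₂} → ¬ x₀ ≈ 0# → Pivot (x₀ , x₁ , x₂)
    pivot₁ : ∀ {x₀ x₁ x₂} → x₀ ≈ 0# → ¬ x₁ ≈ 0# → Pivot (x₀ , x₁ , x₂)
    pivot₂ : ∀ {x₀ x₁ x₂} → x₀ ≈ 0# → x₁ ≈ 0# → ¬ x₂ ≈ 0# → Pivot (x₀ , x₁ , x₂)

  pivot : ∀ {X} → NonZero₃ X → Pivot X
  pivot {x₀ , x₁ , x₂} X≢0 with x₀ ≟ 0# | x₁ ≟ 0# | x₂ ≟ 0#
  ... | no  x₀≉0 | _        | _        = pivot₀ x₀≉0
  ... | yes x₀≈0 | no  x₁≉0 | _        = pivot₁ x₀≈0 x₁≉0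
  ... | yes x₀≈0 | yes x₁≈0 | no  x₂≉0 = pivot₂ x₀≈0 x₁≈0 x₂≉0
  ... | yes x₀≈0 | yes x₁≈0 | yes x₂≈0 = contradiction (x₀≈0 , x₁≈0 , x₂≈0) X≢0

  -- Comparing pivot coordinates: if X ∥ Y then y • X ≈₃ x • Y for the pivot entries x of X and y of Y.
  ∥⇒proportional : ∀ {X Y} → NonZero₃ X → NonZero₃ Y → X ∥ Y →
    Σ[ c ∈ Carrier ] Σ[ d ∈ Carrier ] (¬ c ≈ 0#) × (¬ d ≈ 0#) × c • X ≈₃ d • Y
  ∥⇒proportional {x₀ , x₁ , x₂} {y₀ , y₁ , y₂} X≢0 Y≢0 (e₀ , e₁ , e₂) with pivot X≢0
  ... | pivot₀ x₀≉0 =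
    y₀ , x₀ , y₀≉0 , x₀≉0 , *-comm y₀ x₀ , trans (*-comm y₀ x₁) (sym x₀y₁≈x₁y₀) , trans (*-comm y₀ x₂) x₂y₀≈x₀y₂
    where
    x₀y₁≈x₁y₀ = x∙y⁻¹≈ε⇒x≈y _ _ e₂
    x₂y₀≈x₀y₂ = x∙y⁻¹≈ε⇒x≈y _ _ e₁
    y₀≉0 : ¬ y₀ ≈ 0#
    y₀≉0 y₀≈0 = Y≢0 (y₀≈0 , xy≈0⇒y≈0 x₀≉0 (trans x₀y₁≈x₁y₀ (y≈0⇒xy≈0 y₀≈0))
                          , xy≈0⇒y≈0 x₀≉0 (trans (sym x₂y₀≈x₀y₂) (y≈0⇒xy≈0 y₀≈0)))
  ... | pivot₁ x₀≈0 x₁≉0 =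
    y₁ , x₁ , y₁≉0 , x₁≉0 , trans (*-comm y₁ x₀) x₀y₁≈x₁y₀ , *-comm y₁ x₁ , trans (*-comm y₁ x₂) (sym x₁y₂≈x₂y₁)
    where
    x₀y₁≈x₁y₀ = x∙y⁻¹≈ε⇒x≈y _ _ e₂
    x₁y₂≈x₂y₁ = x∙y⁻¹≈ε⇒x≈y _ _ e₀
    y₁≉0 : ¬ y₁ ≈ 0#
    y₁≉0 y₁≈0 = Y≢0 (xy≈0⇒y≈0 x₁≉0 (trans (sym x₀y₁≈x₁y₀) (x≈0⇒xy≈0 x₀≈0)) , y₁≈0
                          , xy≈0⇒y≈0 x₁≉0 (trans x₁y₂≈x₂y₁ (y≈0⇒xy≈0 y₁≈0)))
  ... | pivot₂ x₀≈0 x₁≈0 x₂≉0 =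
    y₂ , x₂ , y₂≉0 , x₂≉0 , trans (*-comm y₂ x₀) (sym x₂y₀≈x₀y₂) , trans (*-comm y₂ x₁) x₁y₂≈x₂y₁ , *-comm y₂ x₂
    where
    x₂y₀≈x₀y₂ = x∙y⁻¹≈ε⇒x≈y _ _ e₁
    x₁y₂≈x₂y₁ = x∙y⁻¹≈ε⇒x≈y _ _ e₀
    y₂≉0 : ¬ y₂ ≈ 0#
    y₂≉0 y₂≈0 = Y≢0 (xy≈0⇒y≈0 x₂≉0 (trans x₂y₀≈x₀y₂ (x≈0⇒xy≈0 x₀≈0))
                          , xy≈0⇒y≈0 x₂≉0 (trans (sym x₁y₂≈x₂y₁) (x≈0⇒xy≈0 x₁≈0)) , y₂≈0)

  Projective : (Vec3 → Bool) → Set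
  Projective h = ∀ {X Y} → NonZero₃ X → NonZero₃ Y → X ∥ Y → h X ≡ h Y

  ∥ᵇ-equiv : ∀ {X Y X′ Y′} → (X ∥ Y → X′ ∥ Y′) → (X′ ∥ Y′ → X ∥ Y) → (X ∥ᵇ Y) ≡ (X′ ∥ᵇ Y′)
  ∥ᵇ-equiv {X} {Y} to from with zero₃? (X ×₃ Y)
  ... | yes X∥Y = ≡.sym (∥⇒∥ᵇ (to X∥Y))
  ... | no  X∦Y = ≡.sym (∦⇒∥ᵇ (X∦Y ∘ from))

  ∥ᵇ-sym : ∀ X Y → (X ∥ᵇ Y) ≡ (Y ∥ᵇ X)
  ∥ᵇ-sym X Y = ∥ᵇ-equiv ∥-sym ∥-sym

  ⊥ᵇ-sym : ∀ X Y → (X ⊥ᵇ Y) ≡ (Y ⊥ᵇ X)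
  ⊥ᵇ-sym X Y = ≈ᵇ-cong (⟨⟩-sym X Y) refl

  ⊥ᵇ-projectiveˡ : ∀ Z → Projective (_⊥ᵇ Z)
  ⊥ᵇ-projectiveˡ Z X≢0 Y≢0 X∥Y with ∥⇒proportional X≢0 Y≢0 X∥Y
  ... | c , d , c≉0 , d≉0 , cX≈dY =
    ≈ᵇ0-scale c≉0 d≉0 (trans (sym (⟨•⟩ c _ Z)) (trans (⟨⟩-cong cX≈dY ≈₃-refl) (⟨•⟩ d _ Z)))

  isotropic-projective : Projective isotropicᵇ
  isotropic-projective {X} {Y} X≢0 Y≢0 X∥Y with ∥⇒proportional X≢0 Y≢0 X∥Y
  ... | c , d , c≉0 , d≉0 , cX≈dY =
    ≈ᵇ0-scale (*-≉0 c≉0 c≉0) (*-≉0 d≉0 d≉0)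
              (trans (sym (Q-• c X)) (trans (⟨⟩-cong cX≈dY cX≈dY) (Q-• d Y)))

  ∥ᵇ-projectiveˡ : ∀ Z → Projective (_∥ᵇ Z)
  ∥ᵇ-projectiveˡ Z {X} {Y} X≢0 Y≢0 X∥Y with ∥⇒proportional X≢0 Y≢0 X∥Y
  ... | c , d , c≉0 , d≉0 , cX≈dY =
    ∥ᵇ-equiv (rescale c≉0 d≉0 cX×Z≈dY×Z) (rescale d≉0 c≉0 (≈₃-sym cX×Z≈dY×Z))
    where
    cX×Z≈dY×Z : c • (X ×₃ Z) ≈₃ d • (Y ×₃ Z)
    cX×Z≈dY×Z = ≈₃-trans (≈₃-sym (×₃-•ˡ c X Z)) (≈₃-trans (×₃-cong cX≈dY ≈₃-refl) (×₃-•ˡ d Y Z))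
    rescale : ∀ {a b U V} → ¬ a ≈ 0# → ¬ b ≈ 0# → a • U ≈₃ b • V → Zero₃ U → Zero₃ V
    rescale {a} a≉0 b≉0 aU≈bV U≈0 = •-Zero₃ b≉0 (≈₃-trans (≈₃-sym aU≈bV) (Zero₃-• a U≈0))


  σ : (Vec3 → Bool) → Bool
  σ f = sumL f points

  affinePoints finitePointsAtInfinity : List Vec3
  affinePoints           = concatMap (λ a → map (λ b → 1# , a , b) elemList) elemList
  finitePointsAtInfinity = map (λ b → 0# , 1# , b) elemList

  σ-expand : ∀ f → σ f ≡ ∑F (λ a → ∑F (λ b → f (1# , a , b)))
                     xor (∑F (λ b → f (0# , 1# , b)) xor (f (0# , 0# , 1#) xor false))
  σ-expand f =
    ≡.trans (sumL-++ f affinePoints _)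
      (≡.cong₂ _xor_
        (≡.trans (sumL-concatMap f _ elemList)
          (≡.trans (sumL-cong (All.universal (λ a → ≡.trans (sumL-map f _ elemList) (sumL-toList _ elems)) elemList))
                   (sumL-toList _ elems)))
        (≡.trans (sumL-++ f finitePointsAtInfinity _)
          (≡.cong (_xor (f (0# , 0# , 1#) xor false)) (≡.trans (sumL-map f _ elemList) (sumL-toList _ elems)))))

  points-nonzero : All NonZero₃ points
  points-nonzero =
    All.++⁺ (All.concat⁺ (All.map⁺ (All.universal (λ _ → everywhere (1≉0 ∘ proj₁)) elemList)))
      (All.++⁺ (everywhere (1≉0 ∘ proj₁ ∘ proj₂)) ((1≉0 ∘ proj₂ ∘ proj₂) ∷ []))
    where
    everywhere : ∀ {f : Carrier → Vec3} → (∀ {b} → NonZero₃ (f b)) → All NonZero₃ (map f elemList)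
    everywhere f≢0 = All.map⁺ (All.universal (λ _ → f≢0) elemList)

  σ-cong : ∀ {f g} → (∀ S → NonZero₃ S → f S ≡ g S) → σ f ≡ σ g
  σ-cong f≗g = sumL-cong (All.map (f≗g _) points-nonzero)

  σ-∧ˡ : ∀ b f → σ (λ S → b ∧ f S) ≡ b ∧ σ f
  σ-∧ˡ b f = sumL-∧ˡ b f points

  σ-comm : ∀ (f : Vec3 → Vec3 → Bool) → σ (λ S → σ (f S)) ≡ σ (λ T → σ (λ S → f S T))
  σ-comm f = sumL-comm f points points

  points-distinct : AllPairs (λ S T → ¬ S ∥ T) points
  points-distinct =
    AllPairs.++⁺ (AllPairs.concat⁺ (All.map⁺ (All.universal (λ _ → line₁-distinct) elemList)) lines₁-distinct)
      (AllPairs.++⁺ line₂-distinct ([] ∷ []) (All.map⁺ (All.universal (λ _ → p₂∦p₃ ∷ []) elemList)))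
      (All.concat⁺ (All.map⁺ (All.universal (λ _ → All.map⁺ (All.universal (λ _ →
        All.++⁺ (All.map⁺ (All.universal (λ _ → p₁∦p₂) elemList)) (p₁∦p₃ ∷ [])) elemList)) elemList)))
    where
    cancel : ∀ {x x′ y y′} → x ≈ x′ → y ≈ y′ → x - y ≈ 0# → x′ ≈ y′
    cancel x≈x′ y≈y′ x-y≈0 = trans (sym x≈x′) (trans (x∙y⁻¹≈ε⇒x≈y _ _ x-y≈0) y≈y′)
    p₁∥p₁ : ∀ {a b a′ b′} → (1# , a , b) ∥ (1# , a′ , b′) → a ≈ a′ × b ≈ b′
    p₁∥p₁ (_ , e₁ , e₂) = sym (cancel (*-identityˡ _) (*-identityʳ _) e₂) , cancel (*-identityʳ _) (*-identityˡ _) e₁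
    p₂∥p₂ : ∀ {b b′} → (0# , 1# , b) ∥ (0# , 1# , b′) → b ≈ b′
    p₂∥p₂ (e₀ , _ , _) = sym (cancel (*-identityˡ _) (*-identityʳ _) e₀)
    p₁∦p₂ : ∀ {a b b′} → ¬ (1# , a , b) ∥ (0# , 1# , b′)
    p₁∦p₂ (_ , _ , e₂) = 1≉0 (cancel (*-identityʳ 1#) (zeroʳ _) e₂)
    p₁∦p₃ : ∀ {a b} → ¬ (1# , a , b) ∥ (0# , 0# , 1#)
    p₁∦p₃ (_ , e₁ , _) = 1≉0 (sym (cancel (zeroʳ _) (*-identityʳ 1#) e₁))
    p₂∦p₃ : ∀ {b} → ¬ (0# , 1# , b) ∥ (0# , 0# , 1#)
    p₂∦p₃ (e₀ , _ , _) = 1≉0 (cancel (*-identityʳ 1#) (zeroʳ _) e₀)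
    line₁-distinct : ∀ {a} → AllPairs (λ S T → ¬ S ∥ T) (map (λ b → 1# , a , b) elemList)
    line₁-distinct = AllPairs.map⁺ (AllPairs.map (λ b≉b′ → b≉b′ ∘ proj₂ ∘ p₁∥p₁) elements-distinct)
    line₂-distinct : AllPairs (λ S T → ¬ S ∥ T) (map (λ b → 0# , 1# , b) elemList)
    line₂-distinct = AllPairs.map⁺ (AllPairs.map (λ b≉b′ → b≉b′ ∘ p₂∥p₂) elements-distinct)
    lines₁-distinct : AllPairs (λ xs ys → All (λ S → All (λ T → ¬ S ∥ T) ys) xs)
                               (map (λ a → map (λ b → 1# , a , b) elemList) elemList)
    lines₁-distinct = AllPairs.map⁺ (AllPairs.map (λ a≉a′ → All.map⁺ (All.universal (λ _ →
      All.map⁺ (All.universal (λ _ → a≉a′ ∘ proj₁ ∘ p₁∥p₁) elemList)) elemList)) elements-distinct)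

  ≈₃•⇒∥ : ∀ {S w c} → S ≈₃ c • w → S ∥ w
  ≈₃•⇒∥ {w = w} {c} S≈cw = ≈₃-trans (×₃-cong S≈cw ≈₃-refl) (•-∥ c w)

  Zero₃⇒∥ : ∀ {X} Y → Zero₃ X → X ∥ Y
  Zero₃⇒∥ Y (x₀ , x₁ , x₂) =
    zero-minus-zero (x≈0⇒xy≈0 x₁) (x≈0⇒xy≈0 x₂) , zero-minus-zero (x≈0⇒xy≈0 x₂) (x≈0⇒xy≈0 x₀) ,
    zero-minus-zero (x≈0⇒xy≈0 x₀) (x≈0⇒xy≈0 x₁)
    where
    zero-minus-zero : ∀ {x y} → x ≈ 0# → y ≈ 0# → x - y ≈ 0#
    zero-minus-zero x≈0 y≈0 = trans (+-cong x≈0 (-‿cong y≈0)) (-‿inverseʳ 0#)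

  -- Only the middle vector needs to be nonzero: a zero vector is parallel to everything.
  ∥-trans : ∀ {X Y Z} → NonZero₃ Y → X ∥ Y → Y ∥ Z → X ∥ Z
  ∥-trans {X} {Y} {Z} Y≢0 X∥Y Y∥Z with zero₃? X
  ... | yes X≈0 = Zero₃⇒∥ Z X≈0
  ... | no  X≢0 = ∥ᵇ⇒∥ (≡.trans (∥ᵇ-projectiveˡ Z X≢0 Y≢0 X∥Y) (∥⇒∥ᵇ Y∥Z))

  representative : ∀ {w} → NonZero₃ w → Σ[ S ∈ Vec3 ] S ∈ points × S ∥ w
  representative {w₀ , w₁ , w₂} w≢0 with pivot w≢0
  ... | pivot₀ w₀≉0 =
    (1# , canonical (w₁ * i) , canonical (w₂ * i)) ,
    ∈-++⁺ˡ (∈-concatMap⁺ _ (lose (∈-elements _) (∈-map⁺ _ (∈-elements _)))) ,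
    ≈₃•⇒∥ (trans (sym (*-inv w₀ w₀≉0)) (*-comm w₀ i) , trans (canonical-≈ _) (*-comm w₁ i) ,
           trans (canonical-≈ _) (*-comm w₂ i))
    where i = inv w₀ w₀≉0
  ... | pivot₁ w₀≈0 w₁≉0 =
    (0# , 1# , canonical (w₂ * i)) ,
    ∈-++⁺ʳ affinePoints (∈-++⁺ˡ (∈-map⁺ _ (∈-elements _))) ,
    ≈₃•⇒∥ (sym (y≈0⇒xy≈0 w₀≈0) , trans (sym (*-inv w₁ w₁≉0)) (*-comm w₁ i) , trans (canonical-≈ _) (*-comm w₂ i))
    where i = inv w₁ w₁≉0
  ... | pivot₂ w₀≈0 w₁≈0 w₂≉0 =
    (0# , 0# , 1#) ,
    ∈-++⁺ʳ affinePoints (∈-++⁺ʳ finitePointsAtInfinity (here ≡.refl)) ,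
    ≈₃•⇒∥ (sym (y≈0⇒xy≈0 w₀≈0) , sym (y≈0⇒xy≈0 w₁≈0) , trans (sym (*-inv w₂ w₂≉0)) (*-comm w₂ i))
    where i = inv w₂ w₂≉0

  σ-∥ : ∀ {w} → NonZero₃ w → ∀ h → Projective h → σ (λ S → (w ∥ᵇ S) ∧ h S) ≡ h w
  σ-∥ {w} w≢0 h h-projective with representative w≢0
  ... | S , S∈points , S∥w =
    ≡.trans (sumL-unique (w ∥ᵇ_) h (AllPairs.map exclusive points-distinct) S∈points (∥⇒∥ᵇ (∥-sym S∥w)))
            (h-projective (All.lookup points-nonzero S∈points) w≢0 S∥w)
    where
    exclusive : ∀ {T U} → ¬ T ∥ U → ((w ∥ᵇ T) ∧ (w ∥ᵇ U)) ≡ false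
    exclusive {T} {U} T∦U with zero₃? (w ×₃ T) | zero₃? (w ×₃ U)
    ... | yes w∥T | yes w∥U = contradiction (∥-trans w≢0 (∥-sym w∥T) w∥U) T∦U
    ... | yes _   | no  _   = ≡.refl
    ... | no  _   | _       = ≡.refl

  Respects≈₃ : (Vec3 → Bool) → Set
  Respects≈₃ g = ∀ {X Y} → X ≈₃ Y → g X ≡ g Y

  LineSum : Vec3 → Vec3 → Vec3 → Set
  LineSum l u v = ∀ g → Respects≈₃ g → σ (λ S → (dot l S ≈ᵇ 0#) ∧ g S) ≡ ∑F (λ t → g (u +₃ t • v)) xor g v

  record LineParametrisation (l : Vec3) : Set where
    field
      u v    : Vec3
      κ      : Carrier
      κ≉0    : ¬ κ ≈ 0#
      u×v≈κl : u ×₃ v ≈₃ κ • l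
      σ-line : LineSum l u v

  line-last : ∀ {l₀ l₁ l₂} → ¬ l₂ ≈ 0# → LineParametrisation (l₀ , l₁ , l₂)
  line-last {l₀} {l₁} {l₂} l₂≉0 = record
    { u = u ; v = v ; κ = i ; κ≉0 = inv-≉0 l₂≉0 ; u×v≈κl = u×v≈il ; σ-line = σ-line }
    where
    i = inv l₂ l₂≉0
    u = 1# , 0# , - (l₀ * i)
    v = 0# , 1# , - (l₁ * i)
    u×v≈il : u ×₃ v ≈₃ i • (l₀ , l₁ , l₂)
    u×v≈il =
      trans (solve 4 (λ l₀ l₁ i o → :0 :* (:- (l₁ :* i)) :- (:- (l₀ :* i)) :* o := i :* l₀ :* o)
                     refl l₀ l₁ i 1#)
            (*-identityʳ _) ,
      trans (solve 4 (λ l₀ l₁ i o → (:- (l₀ :* i)) :* :0 :- o :* (:- (l₁ :* i)) := o :* (i :* l₁))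
                     refl l₀ l₁ i 1#)
            (*-identityˡ _) ,
      trans (solve 1 (λ o → o :* o :- :0 :* :0 := o :* o) refl 1#)
            (trans (*-identityʳ 1#) (sym (trans (*-comm i l₂) (*-inv l₂ l₂≉0))))
    σ-line : LineSum (l₀ , l₁ , l₂) u v
    σ-line g g-resp =
      ≡.trans (σ-expand _)
        (≡.cong₂ _xor_ affine (≡.trans (≡.cong₂ _xor_ infinite ∞-point) (xor-identityʳ (g v))))
      where
      on-u+av : ∀ a → (1# , a , - ((l₀ * 1# + l₁ * a) * i)) ≈₃ u +₃ a • v
      on-u+av a =
        sym (trans (+-congˡ (zeroʳ a)) (+-identityʳ 1#)) ,
        sym (trans (+-identityˡ _) (*-identityʳ a)) ,
        sym (trans (solve 4 (λ l₀ l₁ i a → :- (l₀ :* i) :+ a :* (:- (l₁ :* i)) := :- ((l₀ :+ l₁ :* a) :* i))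
                            refl l₀ l₁ i a)
                   (-‿cong (*-congʳ (+-congʳ (sym (*-identityʳ l₀))))))
      affine : ∑F (λ a → ∑F (λ b → (l₀ * 1# + l₁ * a + l₂ * b ≈ᵇ 0#) ∧ g (1# , a , b)))
             ≡ ∑F (λ t → g (u +₃ t • v))
      affine = ∑F-cong (λ a → ≡.trans (∑F-linear l₂≉0 _ (λ b → g (1# , a , b)) (λ e → g-resp (refl , refl , e)))
                                      (g-resp (on-u+av a)))
      infinite : ∑F (λ b → (l₀ * 0# + l₁ * 1# + l₂ * b ≈ᵇ 0#) ∧ g (0# , 1# , b)) ≡ g v
      infinite = ≡.trans (∑F-linear l₂≉0 _ (λ b → g (0# , 1# , b)) (λ e → g-resp (refl , refl , e)))
        (g-resp (refl , refl , -‿cong (*-congʳ (trans (+-congʳ (zeroʳ l₀)) (trans (+-identityˡ _) (*-identityʳ l₁))))))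
      ∞-point : ((l₀ * 0# + l₁ * 0# + l₂ * 1# ≈ᵇ 0#) ∧ g (0# , 0# , 1#)) xor false ≡ false
      ∞-point = ≡.cong (λ b → (b ∧ g (0# , 0# , 1#)) xor false) (≉⇒≈ᵇ (λ e → l₂≉0 (begin
        l₂                               ≈⟨ *-identityʳ l₂ ⟨
        l₂ * 1#                          ≈⟨ +-identityˡ _ ⟨
        0# + l₂ * 1#                     ≈⟨ +-congʳ (trans (+-cong (zeroʳ l₀) (zeroʳ l₁)) (+-identityˡ 0#)) ⟨
        l₀ * 0# + l₁ * 0# + l₂ * 1#      ≈⟨ e ⟩
        0#                               ∎)))

  line-middle : ∀ {l₀ l₁ l₂} → l₂ ≈ 0# → ¬ l₁ ≈ 0# → LineParametrisation (l₀ , l₁ , l₂)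
  line-middle {l₀} {l₁} {l₂} l₂≈0 l₁≉0 = record
    { u = u ; v = v ; κ = - i ; κ≉0 = inv-≉0 l₁≉0 ∘ -x≈0⇒x≈0 ; u×v≈κl = u×v≈-il ; σ-line = σ-line }
    where
    i = inv l₁ l₁≉0
    c = - (l₀ * i)
    u = 1# , c , 0#
    v = 0# , 0# , 1#
    u×v≈-il : u ×₃ v ≈₃ - i • (l₀ , l₁ , l₂)
    u×v≈-il =
      trans (solve 2 (λ c o → c :* o :- :0 :* :0 := c :* o) refl c 1#)
            (trans (*-identityʳ c) (solve 2 (λ l₀ i → :- (l₀ :* i) := (:- i) :* l₀) refl l₀ i)) ,
      trans (solve 1 (λ o → :0 :* :0 :- o :* o := :- (o :* o)) refl 1#)
            (trans (-‿cong (trans (*-identityʳ 1#) (sym (*-inv l₁ l₁≉0))))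
                   (solve 2 (λ l₁ i → :- (l₁ :* i) := (:- i) :* l₁) refl l₁ i)) ,
      trans (solve 2 (λ o c → o :* :0 :- c :* :0 := :0) refl 1# c) (sym (y≈0⇒xy≈0 l₂≈0))
    σ-line : LineSum (l₀ , l₁ , l₂) u v
    σ-line g g-resp = ≡.trans (σ-expand _) (≡.cong₂ _xor_ affine (≡.cong₂ _xor_ infinite ∞-point))
      where
      on-line : ∀ a b → l₀ * 1# + l₁ * a + l₂ * b ≈ l₀ + l₁ * a
      on-line a b = trans (+-cong (+-congʳ (*-identityʳ l₀)) (x≈0⇒xy≈0 l₂≈0)) (+-identityʳ _)
      on-u+tv : ∀ t → (1# , c , t) ≈₃ u +₃ t • v
      on-u+tv t = sym (trans (+-congˡ (zeroʳ t)) (+-identityʳ 1#)) ,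
                  sym (trans (+-congˡ (zeroʳ t)) (+-identityʳ c)) ,
                  sym (trans (+-identityˡ _) (*-identityʳ t))
      affine : ∑F (λ a → ∑F (λ b → (l₀ * 1# + l₁ * a + l₂ * b ≈ᵇ 0#) ∧ g (1# , a , b)))
             ≡ ∑F (λ t → g (u +₃ t • v))
      affine =
        ≡.trans (∑F-cong (λ a → ≡.trans (∑F-cong (λ b → ≡.cong (_∧ g (1# , a , b)) (a-fixed a b)))
                                        (∑-∧ˡ (a ≈ᵇ c) (λ k → g (1# , a , Vec.lookup elems k)))))
          (≡.trans (∑F-delta c (λ a → ∑F (λ b → g (1# , a , b)))
                             (λ e → ∑F-cong (λ b → g-resp {1# , _ , b} (refl , e , refl))))
                   (∑F-cong (λ t → g-resp (on-u+tv t))))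
        where
        a-fixed : ∀ a b → (l₀ * 1# + l₁ * a + l₂ * b ≈ᵇ 0#) ≡ (a ≈ᵇ c)
        a-fixed a b = ≡.trans (≈ᵇ-cong (on-line a b) refl) (≈ᵇ0-linear l₁≉0 l₀ a)
      infinite : ∑F (λ b → (l₀ * 0# + l₁ * 1# + l₂ * b ≈ᵇ 0#) ∧ g (0# , 1# , b)) ≡ false
      infinite = ∑F-zero (λ b → ≡.cong (_∧ g (0# , 1# , b))
        (≉⇒≈ᵇ {l₀ * 0# + l₁ * 1# + l₂ * b} (λ e → l₁≉0 (begin
        l₁                            ≈⟨ trans (+-congʳ (zeroʳ l₀)) (trans (+-identityˡ _) (*-identityʳ l₁)) ⟨
        l₀ * 0# + l₁ * 1#             ≈⟨ +-identityʳ _ ⟨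
        l₀ * 0# + l₁ * 1# + 0#        ≈⟨ +-congˡ (x≈0⇒xy≈0 l₂≈0) ⟨
        l₀ * 0# + l₁ * 1# + l₂ * b    ≈⟨ e ⟩
        0#                            ∎))))
      ∞-point : ((l₀ * 0# + l₁ * 0# + l₂ * 1# ≈ᵇ 0#) ∧ g v) xor false ≡ g v
      ∞-point = ≡.trans (≡.cong (λ b → (b ∧ g v) xor false) (≈⇒≈ᵇ (begin
        l₀ * 0# + l₁ * 0# + l₂ * 1#   ≈⟨ +-cong (trans (+-cong (zeroʳ l₀) (zeroʳ l₁)) (+-identityˡ 0#)) (x≈0⇒xy≈0 l₂≈0) ⟩
        0# + 0#                       ≈⟨ +-identityˡ 0# ⟩
        0#                            ∎)))
        (xor-identityʳ (g v))

  line-first : ∀ {l₀ l₁ l₂} → l₂ ≈ 0# → l₁ ≈ 0# → ¬ l₀ ≈ 0# → LineParametrisation (l₀ , l₁ , l₂)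
  line-first {l₀} {l₁} {l₂} l₂≈0 l₁≈0 l₀≉0 = record
    { u = u ; v = v ; κ = i ; κ≉0 = inv-≉0 l₀≉0 ; u×v≈κl = u×v≈il ; σ-line = σ-line }
    where
    i = inv l₀ l₀≉0
    u = 0# , 1# , 0#
    v = 0# , 0# , 1#
    u×v≈il : u ×₃ v ≈₃ i • (l₀ , l₁ , l₂)
    u×v≈il =
      trans (solve 1 (λ o → o :* o :- :0 :* :0 := o :* o) refl 1#)
            (trans (*-identityʳ 1#) (sym (trans (*-comm i l₀) (*-inv l₀ l₀≉0)))) ,
      trans (solve 1 (λ o → :0 :* :0 :- :0 :* o := :0) refl 1#) (sym (y≈0⇒xy≈0 l₁≈0)) ,
      trans (solve 1 (λ o → :0 :* :0 :- o :* :0 := :0) refl 1#) (sym (y≈0⇒xy≈0 l₂≈0))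
    σ-line : LineSum (l₀ , l₁ , l₂) u v
    σ-line g g-resp = ≡.trans (σ-expand _) (≡.cong₂ _xor_ affine (≡.cong₂ _xor_ infinite ∞-point))
      where
      affine : ∑F (λ a → ∑F (λ b → (l₀ * 1# + l₁ * a + l₂ * b ≈ᵇ 0#) ∧ g (1# , a , b))) ≡ false
      affine = ∑F-zero (λ a → ∑F-zero (λ b → ≡.cong (_∧ g (1# , a , b))
        (≉⇒≈ᵇ {l₀ * 1# + l₁ * a + l₂ * b} (λ e → l₀≉0 (begin
          l₀                          ≈⟨ trans (+-identityʳ _) (+-identityʳ l₀) ⟨
          l₀ + 0# + 0#                ≈⟨ +-cong (+-cong (*-identityʳ l₀) (x≈0⇒xy≈0 l₁≈0)) (x≈0⇒xy≈0 l₂≈0) ⟨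
          l₀ * 1# + l₁ * a + l₂ * b   ≈⟨ e ⟩
          0#                          ∎)))))
      infinite : ∑F (λ b → (l₀ * 0# + l₁ * 1# + l₂ * b ≈ᵇ 0#) ∧ g (0# , 1# , b)) ≡ ∑F (λ t → g (u +₃ t • v))
      infinite = ∑F-cong (λ b → ≡.trans (≡.cong (_∧ g (0# , 1# , b)) (≈⇒≈ᵇ (begin
          l₀ * 0# + l₁ * 1# + l₂ * b  ≈⟨ +-cong (+-cong (zeroʳ l₀) (trans (*-identityʳ l₁) l₁≈0)) (x≈0⇒xy≈0 l₂≈0) ⟩
          0# + 0# + 0#                ≈⟨ trans (+-identityʳ _) (+-identityʳ 0#) ⟩
          0#                          ∎)))
        (g-resp (sym (trans (+-congˡ (zeroʳ b)) (+-identityʳ 0#)) ,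
                 sym (trans (+-congˡ (zeroʳ b)) (+-identityʳ 1#)) ,
                 sym (trans (+-identityˡ _) (*-identityʳ b)))))
      ∞-point : ((l₀ * 0# + l₁ * 0# + l₂ * 1# ≈ᵇ 0#) ∧ g v) xor false ≡ g v
      ∞-point = ≡.trans (≡.cong (λ b → (b ∧ g v) xor false) (≈⇒≈ᵇ (begin
        l₀ * 0# + l₁ * 0# + l₂ * 1#   ≈⟨ +-cong (trans (+-cong (zeroʳ l₀) (zeroʳ l₁)) (+-identityˡ 0#)) (x≈0⇒xy≈0 l₂≈0) ⟩
        0# + 0#                       ≈⟨ +-identityˡ 0# ⟩
        0#                            ∎)))
        (xor-identityʳ (g v))

  lineParametrisation : ∀ {l} → NonZero₃ l → LineParametrisation l
  lineParametrisation {l₀ , l₁ , l₂} l≢0 with l₂ ≟ 0# | l₁ ≟ 0# | l₀ ≟ 0#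
  ... | no  l₂≉0 | _        | _        = line-last l₂≉0
  ... | yes l₂≈0 | no  l₁≉0 | _        = line-middle l₂≈0 l₁≉0
  ... | yes l₂≈0 | yes l₁≈0 | no  l₀≉0 = line-first l₂≈0 l₁≈0 l₀≉0
  ... | yes l₂≈0 | yes l₁≈0 | yes l₀≈0 = contradiction (l₀≈0 , l₁≈0 , l₂≈0) l≢0

  ⊥ᵇ≡dot-G : ∀ X S → (X ⊥ᵇ S) ≡ (dot (G X) S ≈ᵇ 0#)
  ⊥ᵇ≡dot-G X S = ≈ᵇ-cong (⟨⟩≈dot-G X S) refl

  isotropic-respects : Respects≈₃ isotropicᵇ
  isotropic-respects X≈Y = ≈ᵇ-cong (⟨⟩-cong X≈Y X≈Y) refl

  ∥-on-line : ∀ {w S} k → NonZero₃ w → NonZero₃ S → w ∥ S → dot k w ≈ 0# → dot k S ≈ 0#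
  ∥-on-line {w} {S} k w≢0 S≢0 w∥S kw≈0 with ∥⇒proportional w≢0 S≢0 w∥S
  ... | c , d , c≉0 , d≉0 , cw≈dS = xy≈0⇒y≈0 d≉0 (begin
    d * dot k S     ≈⟨ dot-• d k S ⟨
    dot k (d • S)   ≈⟨ dot-congʳ k (≈₃-sym cw≈dS) ⟩
    dot k (c • w)   ≈⟨ dot-• c k w ⟩
    c * dot k w     ≈⟨ y≈0⇒xy≈0 kw≈0 ⟩
    0#              ∎)

  on-both-lines : ∀ l m S → NonZero₃ (l ×₃ m) → NonZero₃ S →
    ((dot l S ≈ᵇ 0#) ∧ (dot m S ≈ᵇ 0#)) ≡ ((l ×₃ m) ∥ᵇ S)
  on-both-lines l m S w≢0 S≢0 with dot l S ≟ 0# | dot m S ≟ 0# | zero₃? ((l ×₃ m) ×₃ S)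
  ... | yes _    | yes _    | yes _   = ≡.refl
  ... | no  _    | _        | no  _   = ≡.refl
  ... | yes _    | no  _    | no  _   = ≡.refl
  ... | yes lS≈0 | yes mS≈0 | no  w∦S =
    contradiction (≈₃-trans (×₃-×₃ l m S) (vanishes lS≈0 mS≈0)) w∦S
    where
    vanishes : ∀ {a b} → a ≈ 0# → b ≈ 0# → a • m +₃ - b • l ≈₃ (0# , 0# , 0#)
    vanishes a≈0 b≈0 = both a≈0 -b≈0 , both a≈0 -b≈0 , both a≈0 -b≈0
      where
      -b≈0 = trans (-‿cong b≈0) -0#≈0#
      both : ∀ {a b x y} → a ≈ 0# → b ≈ 0# → a * x + b * y ≈ 0#
      both a≈0 b≈0 = trans (+-cong (x≈0⇒xy≈0 a≈0) (x≈0⇒xy≈0 b≈0)) (+-identityˡ 0#)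
  ... | no  lS≉0 | _        | yes w∥S = contradiction (∥-on-line l w≢0 S≢0 w∥S (dot-×₃ˡ l m)) lS≉0
  ... | yes _    | no  mS≉0 | yes w∥S = contradiction (∥-on-line m w≢0 S≢0 w∥S (dot-×₃ʳ l m)) mS≉0

  isotropicᵇ⇒Q≈0 : ∀ {X} → isotropicᵇ X ≡ true → Q X ≈ 0#
  isotropicᵇ⇒Q≈0 = ≈ᵇ⇒≈

  -- The tangent line at a point of the conic meets the conic only at that point.
  isotropic-⊥ᵇ≡∥ᵇ : ∀ {X S} → NonZero₃ X → NonZero₃ S → isotropicᵇ X ≡ true → isotropicᵇ S ≡ true →
    (X ⊥ᵇ S) ≡ (X ∥ᵇ S)
  isotropic-⊥ᵇ≡∥ᵇ {X} {S} X≢0 S≢0 X-iso S-iso with ⟨ X , S ⟩ ≟ 0# | zero₃? (X ×₃ S)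
  ... | yes _   | yes _   = ≡.refl
  ... | no  _   | no  _   = ≡.refl
  ... | yes X⊥S | no  X∦S = contradiction (G×₃G-Zero₃ X S (∥-trans n≢0 (∥-sym n∥GX) n∥GS)) X∦S
    where
    n≢0 : NonZero₃ (X ×₃ S)
    n≢0 = X∦S
    polar-through : ∀ {Y} → NonZero₃ Y → ⟨ Y , X ⟩ ≈ 0# → ⟨ Y , S ⟩ ≈ 0# → (X ×₃ S) ∥ G Y
    polar-through {Y} Y≢0 YX≈0 YS≈0 = ∥ᵇ⇒∥ (≡.trans (≡.sym (on-both-lines X S (G Y) n≢0 (G-NonZero₃ Y≢0)))
      (≡.cong₂ _∧_ (≈⇒≈ᵇ (trans (dot-comm X (G Y)) (trans (sym (⟨⟩≈dot-G Y X)) YX≈0)))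
                   (≈⇒≈ᵇ (trans (dot-comm S (G Y)) (trans (sym (⟨⟩≈dot-G Y S)) YS≈0)))))
    n∥GX : (X ×₃ S) ∥ G X
    n∥GX = polar-through X≢0 (isotropicᵇ⇒Q≈0 X-iso) X⊥S
    n∥GS : (X ×₃ S) ∥ G S
    n∥GS = polar-through S≢0 (trans (⟨⟩-sym S X) X⊥S) (isotropicᵇ⇒Q≈0 S-iso)
  ... | no  X⊥̸S | yes X∥S with ∥⇒proportional X≢0 S≢0 X∥S
  ...   | c , d , c≉0 , d≉0 , cX≈dS = contradiction (xy≈0⇒y≈0 d≉0 (begin
    d * ⟨ X , S ⟩      ≈⟨ *-congˡ (⟨⟩-sym X S) ⟩
    d * ⟨ S , X ⟩      ≈⟨ ⟨•⟩ d S X ⟨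
    ⟨ d • S , X ⟩      ≈⟨ ⟨⟩-cong (≈₃-sym cX≈dS) ≈₃-refl ⟩
    ⟨ c • X , X ⟩      ≈⟨ ⟨•⟩ c X X ⟩
    c * Q X            ≈⟨ y≈0⇒xy≈0 (isotropicᵇ⇒Q≈0 X-iso) ⟩
    0#                 ∎)) X⊥̸S

  -- A line not tangent to the conic meets it in 0 or 2 points: the restriction of Q to the
  -- line P^⊥ is a binary quadratic form whose discriminant is -α Q(P) up to a nonzero square.
  isotropic-on-polar-even : q % 2 ≡ 1 → ∀ {P} → NonZero₃ P → isotropicᵇ P ≡ false →
    σ (λ X → isotropicᵇ X ∧ (P ⊥ᵇ X)) ≡ false
  isotropic-on-polar-even q-odd {P} P≢0 P-aniso =
    ≡.trans (σ-cong (λ X _ → ≡.trans (∧-comm (isotropicᵇ X) (P ⊥ᵇ X))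
                                     (≡.cong (_∧ isotropicᵇ X) (⊥ᵇ≡dot-G P X))))
      (≡.trans (σ-line isotropicᵇ isotropic-respects)
        (≡.trans (≡.cong (_xor isotropicᵇ v) (∑F-cong (λ t → ≈ᵇ-cong (Q-line u v t) refl)))
                 (quadratic-roots-even q-odd (Q v) ⟨ u , v ⟩ (Q u) disc≉0)))
    where
    open LineParametrisation (lineParametrisation (G-NonZero₃ P≢0))
    QP≉0 : ¬ Q P ≈ 0#
    QP≉0 QP≈0 = contradiction (≡.trans (≡.sym (≈⇒≈ᵇ QP≈0)) P-aniso) λ ()
    disc≉0 : ¬ Q v * Q u - ⟨ u , v ⟩ * ⟨ u , v ⟩ ≈ 0#
    disc≉0 disc≈0 = *-≉0 (*-≉0 (α≉0 ∘ -x≈0⇒x≈0) (*-≉0 κ≉0 κ≉0)) QP≉0 (begin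
      - α * (κ * κ) * Q P                   ≈⟨ Q⋆-G κ P ⟨
      Q⋆ (κ • G P)                          ≈⟨ Q⋆-cong u×v≈κl ⟨
      Q⋆ (u ×₃ v)                           ≈⟨ lagrange-identity u v ⟨
      Q v * Q u - ⟨ u , v ⟩ * ⟨ u , v ⟩     ≈⟨ disc≈0 ⟩
      0#                                    ∎)

module Counting {q : ℕ} (F : FiniteField q) (q-odd : q % 2 ≡ 1) (α : FiniteField.Carrier F)
                (α≉0 : ¬ FiniteField._≈_ F α (FiniteField.0# F)) where

  open import Data.Bool using (Bool; true; false; _xor_; _∧_; not)
  open import Data.Bool.Properties
    using (∧-comm; ∧-idem; ∧-identityʳ; ∧-zeroʳ; ∧-conicalˡ; ∧-conicalʳ; ∧-distribˡ-xor; ∧-distribʳ-xor;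
           xor-same; xor-identityʳ; xor-assoc; not-distribˡ-xor; ∧-commutativeMonoid)
  open import Function using (_∘_)
  open import Relation.Nullary using (yes; no)
  open import Relation.Binary.PropositionalEquality
  open ≡-Reasoning
  open import Algebra.Solver.CommutativeMonoid ∧-commutativeMonoid using (solve; _⊕_; _⊜_)

  open F₂Sums
  open FieldFacts F using (∑F; ∑F-cong; _≈ᵇ_; 0#)
  open PG2 F α using (Vec3; points)
  open Plane F α α≉0

  σA σI : (Vec3 → Bool) → Bool
  σA f = σ (λ S → anisotropicᵇ S ∧ f S)
  σI f = σ (λ S → isotropicᵇ S ∧ f S)

  σ-xor : ∀ f g → σ (λ S → f S xor g S) ≡ σ f xor σ g
  σ-xor f g = sumL-xor f g points

  σA-xor : ∀ f g → σA (λ S → f S xor g S) ≡ σA f xor σA g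
  σA-xor f g = trans (σ-cong (λ S _ → ∧-distribˡ-xor (anisotropicᵇ S) (f S) (g S))) (σ-xor _ _)

  σA-xor₃ : ∀ f g h → σA (λ S → f S xor (g S xor h S)) ≡ σA f xor (σA g xor σA h)
  σA-xor₃ f g h = trans (σA-xor f _) (cong (σA f xor_) (σA-xor g h))

  σA≡σ-σI : ∀ f → σA f ≡ σ f xor σI f
  σA≡σ-σI f = sym (trans (sym (σ-xor f _)) (σ-cong (λ S _ → remove-isotropic (isotropicᵇ S) (f S))))
    where
    remove-isotropic : ∀ i x → (x xor (i ∧ x)) ≡ (not i ∧ x)
    remove-isotropic true  x = xor-same x
    remove-isotropic false x = xor-identityʳ x

  ∧-absorbs : ∀ a {f} → (a ≡ true → f ≡ true) → (a ∧ f) ≡ a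
  ∧-absorbs true  f-true = f-true refl
  ∧-absorbs false _      = refl

  ∑F-true : ∑F (λ _ → true) ≡ true
  ∑F-true = ∑-true-odd q q-odd

  σ-true : σ (λ _ → true) ≡ true
  σ-true = trans (σ-expand _) (cong₂ _xor_ (trans (∑F-cong (λ _ → ∑F-true)) ∑F-true) (cong (_xor true) ∑F-true))

  points-on-line-even : ∀ {l} → NonZero₃ l → σ (λ S → dot l S ≈ᵇ 0#) ≡ false
  points-on-line-even {l} l≢0 = begin
    σ (λ S → dot l S ≈ᵇ 0#)
      ≡⟨ σ-cong (λ S _ → sym (∧-identityʳ _)) ⟩
    σ (λ S → (dot l S ≈ᵇ 0#) ∧ true)
      ≡⟨ LineParametrisation.σ-line (lineParametrisation l≢0) (λ _ → true) (λ _ → refl) ⟩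
    ∑F (λ _ → true) xor true
      ≡⟨ cong (_xor true) ∑F-true ⟩
    false
      ∎

  σ-⊥⊥ : ∀ {X Z} → NonZero₃ X → NonZero₃ Z → σ (λ S → (X ⊥ᵇ S) ∧ (S ⊥ᵇ Z)) ≡ not (X ∥ᵇ Z)
  σ-⊥⊥ {X} {Z} X≢0 Z≢0 with zero₃? (X ×₃ Z)
  ... | yes X∥Z = trans (σ-cong same-line) (points-on-line-even (G-NonZero₃ X≢0))
    where
    same-line : ∀ S → NonZero₃ S → ((X ⊥ᵇ S) ∧ (S ⊥ᵇ Z)) ≡ (dot (G X) S ≈ᵇ 0#)
    same-line S S≢0 = begin
      (X ⊥ᵇ S) ∧ (S ⊥ᵇ Z)
        ≡⟨ cong ((X ⊥ᵇ S) ∧_) (trans (⊥ᵇ-sym S Z) (⊥ᵇ-projectiveˡ S Z≢0 X≢0 (∥-sym X∥Z))) ⟩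
      (X ⊥ᵇ S) ∧ (X ⊥ᵇ S)
        ≡⟨ ∧-idem _ ⟩
      X ⊥ᵇ S
        ≡⟨ ⊥ᵇ≡dot-G X S ⟩
      dot (G X) S ≈ᵇ 0#
        ∎
  ... | no  X∦Z = trans (σ-cong meet) (σ-∥ w≢0 (λ _ → true) (λ _ _ _ → refl))
    where
    w = G X ×₃ G Z
    w≢0 : NonZero₃ w
    w≢0 = X∦Z ∘ G×₃G-Zero₃ X Z
    meet : ∀ S → NonZero₃ S → ((X ⊥ᵇ S) ∧ (S ⊥ᵇ Z)) ≡ ((w ∥ᵇ S) ∧ true)
    meet S S≢0 = begin
      (X ⊥ᵇ S) ∧ (S ⊥ᵇ Z)
        ≡⟨ cong₂ _∧_ (⊥ᵇ≡dot-G X S) (trans (⊥ᵇ-sym S Z) (⊥ᵇ≡dot-G Z S)) ⟩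
      (dot (G X) S ≈ᵇ 0#) ∧ (dot (G Z) S ≈ᵇ 0#)
        ≡⟨ on-both-lines (G X) (G Z) S w≢0 S≢0 ⟩
      w ∥ᵇ S
        ≡⟨ ∧-identityʳ _ ⟨
      (w ∥ᵇ S) ∧ true
        ∎

  σI-⊥ᵇ∧ : ∀ {X} → NonZero₃ X → isotropicᵇ X ≡ true → ∀ h → Projective h →
    σI (λ S → (X ⊥ᵇ S) ∧ h S) ≡ h X
  σI-⊥ᵇ∧ {X} X≢0 X-iso h h-projective = begin
    σ (λ S → isotropicᵇ S ∧ ((X ⊥ᵇ S) ∧ h S))
      ≡⟨ σ-cong tangent ⟩
    σ (λ S → (X ∥ᵇ S) ∧ (isotropicᵇ S ∧ h S))
      ≡⟨ σ-∥ X≢0 _ iso∧h-projective ⟩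
    isotropicᵇ X ∧ h X
      ≡⟨ cong (_∧ h X) X-iso ⟩
    h X
      ∎
    where
    tangent : ∀ S → NonZero₃ S → (isotropicᵇ S ∧ ((X ⊥ᵇ S) ∧ h S)) ≡ ((X ∥ᵇ S) ∧ (isotropicᵇ S ∧ h S))
    tangent S S≢0 with isotropicᵇ S in S-iso
    ... | true  = cong (_∧ h S) (isotropic-⊥ᵇ≡∥ᵇ X≢0 S≢0 X-iso S-iso)
    ... | false = sym (∧-zeroʳ (X ∥ᵇ S))
    iso∧h-projective : Projective (λ S → isotropicᵇ S ∧ h S)
    iso∧h-projective Y≢0 Z≢0 Y∥Z = cong₂ _∧_ (isotropic-projective Y≢0 Z≢0 Y∥Z) (h-projective Y≢0 Z≢0 Y∥Z)

  tangent-anisotropic-odd : ∀ {X} → NonZero₃ X → isotropicᵇ X ≡ true → σA (X ⊥ᵇ_) ≡ true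
  tangent-anisotropic-odd {X} X≢0 X-iso = begin
    σA (X ⊥ᵇ_)
      ≡⟨ σA≡σ-σI _ ⟩
    σ (X ⊥ᵇ_) xor σI (X ⊥ᵇ_)
      ≡⟨ cong₂ _xor_ on-polar on-conic ⟩
    false xor true
      ∎
    where
    on-polar : σ (X ⊥ᵇ_) ≡ false
    on-polar = trans (σ-cong (λ S _ → ⊥ᵇ≡dot-G X S)) (points-on-line-even (G-NonZero₃ X≢0))
    on-conic : σI (X ⊥ᵇ_) ≡ true
    on-conic = trans (σ-cong (λ S _ → cong (isotropicᵇ S ∧_) (sym (∧-identityʳ _))))
                     (σI-⊥ᵇ∧ X≢0 X-iso (λ _ → true) (λ _ _ _ → refl))

  -- Double counting the incidences between conic points X and anisotropic points S with X ⊥ S.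
  isotropic-even : σ isotropicᵇ ≡ false
  isotropic-even = begin
    σ isotropicᵇ
      ≡⟨ σ-cong tangents ⟨
    σ (λ X → isotropicᵇ X ∧ σA (X ⊥ᵇ_))
      ≡⟨ σ-cong (λ X _ → sym (σ-∧ˡ (isotropicᵇ X) _)) ⟩
    σ (λ X → σ (λ S → isotropicᵇ X ∧ (anisotropicᵇ S ∧ (X ⊥ᵇ S))))
      ≡⟨ σ-comm _ ⟩
    σ (λ S → σ (λ X → isotropicᵇ X ∧ (anisotropicᵇ S ∧ (X ⊥ᵇ S))))
      ≡⟨ σ-cong (λ S _ → trans (σ-cong (λ X _ → swap S X)) (σ-∧ˡ (anisotropicᵇ S) _)) ⟩
    σ (λ S → anisotropicᵇ S ∧ σ (λ X → isotropicᵇ X ∧ (S ⊥ᵇ X)))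
      ≡⟨ σ-cong secants ⟩
    σ (λ _ → false)
      ≡⟨ sumL-zero points ⟩
    false
      ∎
    where
    tangents : ∀ X → NonZero₃ X → (isotropicᵇ X ∧ σA (X ⊥ᵇ_)) ≡ isotropicᵇ X
    tangents X X≢0 = ∧-absorbs (isotropicᵇ X) (tangent-anisotropic-odd X≢0)
    swap : ∀ S X → (isotropicᵇ X ∧ (anisotropicᵇ S ∧ (X ⊥ᵇ S))) ≡ (anisotropicᵇ S ∧ (isotropicᵇ X ∧ (S ⊥ᵇ X)))
    swap S X = trans (cong (λ b → isotropicᵇ X ∧ (anisotropicᵇ S ∧ b)) (⊥ᵇ-sym X S))
      (solve 3 (λ i a b → i ⊕ (a ⊕ b) ⊜ a ⊕ (i ⊕ b)) refl (isotropicᵇ X) (anisotropicᵇ S) (S ⊥ᵇ X))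
    secants : ∀ S → NonZero₃ S → (anisotropicᵇ S ∧ σ (λ X → isotropicᵇ X ∧ (S ⊥ᵇ X))) ≡ false
    secants S S≢0 with isotropicᵇ S in S-iso
    ... | true  = refl
    ... | false = isotropic-on-polar-even q-odd S≢0 S-iso

  anisotropic-odd : σA (λ _ → true) ≡ true
  anisotropic-odd = begin
    σA (λ _ → true)
      ≡⟨ σA≡σ-σI _ ⟩
    σ (λ _ → true) xor σI (λ _ → true)
      ≡⟨ cong₂ _xor_ σ-true (trans (σ-cong (λ S _ → ∧-identityʳ _)) isotropic-even) ⟩
    true xor false
      ∎

  K : Vec3 → Vec3 → Bool
  K P R = σI (λ Z → (P ⊥ᵇ Z) ∧ (Z ⊥ᵇ R))

  -- The entries of A₁₁²: J - I corrected by K.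
  M : Vec3 → Vec3 → Bool
  M P R = not (P ∥ᵇ R) xor K P R

  σA-⊥⊥ : ∀ {P R} → NonZero₃ P → NonZero₃ R → σA (λ S → (P ⊥ᵇ S) ∧ (S ⊥ᵇ R)) ≡ M P R
  σA-⊥⊥ {P} {R} P≢0 R≢0 = trans (σA≡σ-σI _) (cong (_xor K P R) (σ-⊥⊥ P≢0 R≢0))

  K-sym : ∀ P R → K P R ≡ K R P
  K-sym P R = σ-cong (λ Z _ → cong (isotropicᵇ Z ∧_)
    (trans (cong₂ _∧_ (⊥ᵇ-sym P Z) (⊥ᵇ-sym Z R)) (∧-comm (Z ⊥ᵇ P) (R ⊥ᵇ Z))))

  K-projectiveˡ : ∀ R → Projective (λ P → K P R)
  K-projectiveˡ R P≢0 P′≢0 P∥P′ =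
    σ-cong (λ Z _ → cong (λ b → isotropicᵇ Z ∧ (b ∧ (Z ⊥ᵇ R))) (⊥ᵇ-projectiveˡ Z P≢0 P′≢0 P∥P′))

  K-projectiveʳ : ∀ P → Projective (K P)
  K-projectiveʳ P {R} {R′} R≢0 R′≢0 R∥R′ =
    trans (K-sym P R) (trans (K-projectiveˡ P R≢0 R′≢0 R∥R′) (K-sym R′ P))

  M-projectiveˡ : ∀ R → Projective (λ P → M P R)
  M-projectiveˡ R P≢0 P′≢0 P∥P′ =
    cong₂ (λ e k → not e xor k) (∥ᵇ-projectiveˡ R P≢0 P′≢0 P∥P′) (K-projectiveˡ R P≢0 P′≢0 P∥P′)

  σA-∥ : ∀ {P} → NonZero₃ P → isotropicᵇ P ≡ false → ∀ h → Projective h →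
    σA (λ S → (P ∥ᵇ S) ∧ h S) ≡ h P
  σA-∥ {P} P≢0 P-aniso h h-projective = begin
    σ (λ S → anisotropicᵇ S ∧ ((P ∥ᵇ S) ∧ h S))
      ≡⟨ σ-cong (λ S _ → solve 3 (λ a e h → a ⊕ (e ⊕ h) ⊜ e ⊕ (a ⊕ h)) refl (anisotropicᵇ S) (P ∥ᵇ S) (h S)) ⟩
    σ (λ S → (P ∥ᵇ S) ∧ (anisotropicᵇ S ∧ h S))
      ≡⟨ σ-∥ P≢0 _ aniso∧h-projective ⟩
    anisotropicᵇ P ∧ h P
      ≡⟨ cong (λ i → not i ∧ h P) P-aniso ⟩
    h P
      ∎
    where
    aniso∧h-projective : Projective (λ S → anisotropicᵇ S ∧ h S)
    aniso∧h-projective X≢0 Y≢0 X∥Y =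
      cong₂ _∧_ (cong not (isotropic-projective X≢0 Y≢0 X∥Y)) (h-projective X≢0 Y≢0 X∥Y)

  σA-⊥⊥-isotropic : ∀ {X Y} → NonZero₃ X → NonZero₃ Y → isotropicᵇ X ≡ true → isotropicᵇ Y ≡ true →
    σA (λ S → (X ⊥ᵇ S) ∧ (S ⊥ᵇ Y)) ≡ true
  σA-⊥⊥-isotropic {X} {Y} X≢0 Y≢0 X-iso Y-iso = begin
    σA (λ S → (X ⊥ᵇ S) ∧ (S ⊥ᵇ Y))
      ≡⟨ σA-⊥⊥ X≢0 Y≢0 ⟩
    not (X ∥ᵇ Y) xor K X Y
      ≡⟨ cong (not (X ∥ᵇ Y) xor_) (σI-⊥ᵇ∧ X≢0 X-iso (_⊥ᵇ Y) (⊥ᵇ-projectiveˡ Y)) ⟩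
    not (X ∥ᵇ Y) xor (X ⊥ᵇ Y)
      ≡⟨ cong (not (X ∥ᵇ Y) xor_) (isotropic-⊥ᵇ≡∥ᵇ X≢0 Y≢0 X-iso Y-iso) ⟩
    not (X ∥ᵇ Y) xor (X ∥ᵇ Y)
      ≡⟨ not-xor-self (X ∥ᵇ Y) ⟩
    true
      ∎
    where
    not-xor-self : ∀ b → (not b xor b) ≡ true
    not-xor-self true  = refl
    not-xor-self false = refl

  σA-K : ∀ {P} → NonZero₃ P → isotropicᵇ P ≡ false → σA (K P) ≡ false
  σA-K {P} P≢0 P-aniso = begin
    σ (λ S → anisotropicᵇ S ∧ σ (λ Z → isotropicᵇ Z ∧ ((P ⊥ᵇ Z) ∧ (Z ⊥ᵇ S))))
      ≡⟨ σ-cong (λ S _ → sym (σ-∧ˡ _ _)) ⟩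
    σ (λ S → σ (λ Z → anisotropicᵇ S ∧ (isotropicᵇ Z ∧ ((P ⊥ᵇ Z) ∧ (Z ⊥ᵇ S)))))
      ≡⟨ σ-comm _ ⟩
    σ (λ Z → σ (λ S → anisotropicᵇ S ∧ (isotropicᵇ Z ∧ ((P ⊥ᵇ Z) ∧ (Z ⊥ᵇ S)))))
      ≡⟨ σ-cong (λ Z _ → trans (σ-cong (λ S _ → rearrange S Z)) (σ-∧ˡ _ _)) ⟩
    σ (λ Z → (isotropicᵇ Z ∧ (P ⊥ᵇ Z)) ∧ σA (Z ⊥ᵇ_))
      ≡⟨ σ-cong (λ Z Z≢0 → ∧-absorbs _ (tangent-anisotropic-odd Z≢0 ∘ ∧-conicalˡ (isotropicᵇ Z) (P ⊥ᵇ Z))) ⟩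
    σ (λ Z → isotropicᵇ Z ∧ (P ⊥ᵇ Z))
      ≡⟨ isotropic-on-polar-even q-odd P≢0 P-aniso ⟩
    false
      ∎
    where
    rearrange : ∀ S Z → (anisotropicᵇ S ∧ (isotropicᵇ Z ∧ ((P ⊥ᵇ Z) ∧ (Z ⊥ᵇ S))))
                      ≡ ((isotropicᵇ Z ∧ (P ⊥ᵇ Z)) ∧ (anisotropicᵇ S ∧ (Z ⊥ᵇ S)))
    rearrange S Z = solve 4 (λ a i b c → a ⊕ (i ⊕ (b ⊕ c)) ⊜ (i ⊕ b) ⊕ (a ⊕ c)) refl
                            (anisotropicᵇ S) (isotropicᵇ Z) (P ⊥ᵇ Z) (Z ⊥ᵇ S)

  σ-∧-σ : ∀ f g → (σ f ∧ σ g) ≡ σ (λ X → σ (λ Y → f X ∧ g Y))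
  σ-∧-σ f g = sym (trans (σ-cong (λ X _ → σ-∧ˡ (f X) g)) (sumL-∧ʳ (σ g) f points))

  σA-KK : ∀ {P} R → NonZero₃ P → isotropicᵇ P ≡ false → σA (λ S → K P S ∧ K S R) ≡ false
  σA-KK {P} R P≢0 P-aniso = begin
    σ (λ S → anisotropicᵇ S ∧ (K P S ∧ K S R))
      ≡⟨ σ-cong (λ S _ → expand S) ⟩
    σ (λ S → σ (λ X → σ (λ Y → anisotropicᵇ S ∧ (f X S ∧ g S Y))))
      ≡⟨ σ-comm _ ⟩
    σ (λ X → σ (λ S → σ (λ Y → anisotropicᵇ S ∧ (f X S ∧ g S Y))))
      ≡⟨ σ-cong (λ X _ → σ-comm _) ⟩
    σ (λ X → σ (λ Y → σ (λ S → anisotropicᵇ S ∧ (f X S ∧ g S Y))))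
      ≡⟨ σ-cong (λ X X≢0 → σ-cong (λ Y Y≢0 → through-conic X≢0 Y≢0)) ⟩
    σ (λ X → σ (λ Y → (isotropicᵇ X ∧ (P ⊥ᵇ X)) ∧ (isotropicᵇ Y ∧ (Y ⊥ᵇ R))))
      ≡⟨ σ-∧-σ _ _ ⟨
    σ (λ X → isotropicᵇ X ∧ (P ⊥ᵇ X)) ∧ σ (λ Y → isotropicᵇ Y ∧ (Y ⊥ᵇ R))
      ≡⟨ cong (_∧ _) (isotropic-on-polar-even q-odd P≢0 P-aniso) ⟩
    false
      ∎
    where
    f g : Vec3 → Vec3 → Bool
    f X S = isotropicᵇ X ∧ ((P ⊥ᵇ X) ∧ (X ⊥ᵇ S))
    g S Y = isotropicᵇ Y ∧ ((S ⊥ᵇ Y) ∧ (Y ⊥ᵇ R))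
    expand : ∀ S → (anisotropicᵇ S ∧ (K P S ∧ K S R)) ≡ σ (λ X → σ (λ Y → anisotropicᵇ S ∧ (f X S ∧ g S Y)))
    expand S = trans (cong (anisotropicᵇ S ∧_) (σ-∧-σ (λ X → f X S) (g S)))
      (trans (sym (σ-∧ˡ (anisotropicᵇ S) _)) (σ-cong (λ X _ → sym (σ-∧ˡ (anisotropicᵇ S) _))))
    through-conic : ∀ {X Y} → NonZero₃ X → NonZero₃ Y →
      σ (λ S → anisotropicᵇ S ∧ (f X S ∧ g S Y)) ≡ (isotropicᵇ X ∧ (P ⊥ᵇ X)) ∧ (isotropicᵇ Y ∧ (Y ⊥ᵇ R))
    through-conic {X} {Y} X≢0 Y≢0 =
      trans (σ-cong (λ S _ → rearrange S)) (trans (σ-∧ˡ _ _) (∧-absorbs _ both-on-conic))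
      where
      iX∧PX = isotropicᵇ X ∧ (P ⊥ᵇ X)
      iY∧YR = isotropicᵇ Y ∧ (Y ⊥ᵇ R)
      rearrange : ∀ S → (anisotropicᵇ S ∧ (f X S ∧ g S Y))
                      ≡ ((iX∧PX ∧ iY∧YR) ∧ (anisotropicᵇ S ∧ ((X ⊥ᵇ S) ∧ (S ⊥ᵇ Y))))
      rearrange S =
        solve 7 (λ a i b c j d e → a ⊕ ((i ⊕ (b ⊕ c)) ⊕ (j ⊕ (d ⊕ e))) ⊜ ((i ⊕ b) ⊕ (j ⊕ e)) ⊕ (a ⊕ (c ⊕ d)))
          refl (anisotropicᵇ S) (isotropicᵇ X) (P ⊥ᵇ X) (X ⊥ᵇ S) (isotropicᵇ Y) (S ⊥ᵇ Y) (Y ⊥ᵇ R)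
      both-on-conic : (iX∧PX ∧ iY∧YR) ≡ true → σA (λ S → (X ⊥ᵇ S) ∧ (S ⊥ᵇ Y)) ≡ true
      both-on-conic on-conics = σA-⊥⊥-isotropic X≢0 Y≢0
        (∧-conicalˡ _ (P ⊥ᵇ X) (∧-conicalˡ iX∧PX iY∧YR on-conics))
        (∧-conicalˡ _ (Y ⊥ᵇ R) (∧-conicalʳ iX∧PX iY∧YR on-conics))

  M-unfold : ∀ P R → M P R ≡ true xor ((P ∥ᵇ R) xor K P R)
  M-unfold P R = sym (not-distribˡ-xor (P ∥ᵇ R) (K P R))

  σA-M : ∀ {R} → NonZero₃ R → isotropicᵇ R ≡ false → σA (λ S → M S R) ≡ false
  σA-M {R} R≢0 R-aniso = begin
    σA (λ S → M S R)
      ≡⟨ σ-cong (λ S _ → cong (anisotropicᵇ S ∧_) (M-unfold S R)) ⟩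
    σA (λ S → true xor ((S ∥ᵇ R) xor K S R))
      ≡⟨ σA-xor₃ (λ _ → true) (_∥ᵇ R) (λ S → K S R) ⟩
    σA (λ _ → true) xor (σA (_∥ᵇ R) xor σA (λ S → K S R))
      ≡⟨ cong₂ (λ n x → n xor (x xor σA (λ S → K S R))) anisotropic-odd through-R ⟩
    true xor (true xor σA (λ S → K S R))
      ≡⟨ cong (λ k → true xor (true xor k)) (trans (σ-cong (λ S _ → cong (anisotropicᵇ S ∧_) (K-sym S R)))
                                                   (σA-K R≢0 R-aniso)) ⟩
    false
      ∎
    where
    through-R : σA (_∥ᵇ R) ≡ true
    through-R = trans (σ-cong (λ S _ → cong (anisotropicᵇ S ∧_) (trans (∥ᵇ-sym S R) (sym (∧-identityʳ _)))))
                      (σA-∥ R≢0 R-aniso (λ _ → true) (λ _ _ _ → refl))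

  σA-K-M : ∀ {P R} → NonZero₃ P → NonZero₃ R → isotropicᵇ P ≡ false → isotropicᵇ R ≡ false →
    σA (λ S → K P S ∧ M S R) ≡ K P R
  σA-K-M {P} {R} P≢0 R≢0 P-aniso R-aniso = begin
    σA (λ S → K P S ∧ M S R)
      ≡⟨ σ-cong (λ S _ → cong (anisotropicᵇ S ∧_) (distribute S)) ⟩
    σA (λ S → K P S xor ((K P S ∧ (S ∥ᵇ R)) xor (K P S ∧ K S R)))
      ≡⟨ σA-xor₃ (K P) (λ S → K P S ∧ (S ∥ᵇ R)) (λ S → K P S ∧ K S R) ⟩
    σA (K P) xor (σA (λ S → K P S ∧ (S ∥ᵇ R)) xor σA (λ S → K P S ∧ K S R))
      ≡⟨ cong₂ (λ k x → k xor (x xor σA (λ S → K P S ∧ K S R))) (σA-K P≢0 P-aniso) through-R ⟩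
    false xor (K P R xor σA (λ S → K P S ∧ K S R))
      ≡⟨ cong (K P R xor_) (σA-KK R P≢0 P-aniso) ⟩
    K P R xor false
      ≡⟨ xor-identityʳ (K P R) ⟩
    K P R
      ∎
    where
    distribute : ∀ S → (K P S ∧ M S R) ≡ (K P S xor ((K P S ∧ (S ∥ᵇ R)) xor (K P S ∧ K S R)))
    distribute S = trans (cong (K P S ∧_) (M-unfold S R))
      (trans (∧-distribˡ-xor (K P S) true _) (cong₂ _xor_ (∧-identityʳ (K P S)) (∧-distribˡ-xor (K P S) _ _)))
    through-R : σA (λ S → K P S ∧ (S ∥ᵇ R)) ≡ K P R
    through-R = trans (σ-cong (λ S _ → cong (anisotropicᵇ S ∧_) (trans (∧-comm (K P S) _) (cong (_∧ K P S) (∥ᵇ-sym S R)))))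
                      (σA-∥ R≢0 R-aniso (K P) (K-projectiveʳ P))

  -- (A₁₁⁴)_{PR} = ∑_S M P S · M S R, expanded along M P S = 1 + [P ∥ S] + K P S.
  σA-M-M : ∀ {P R} → NonZero₃ P → NonZero₃ R → isotropicᵇ P ≡ false → isotropicᵇ R ≡ false →
    σA (λ S → M P S ∧ M S R) ≡ not (P ∥ᵇ R)
  σA-M-M {P} {R} P≢0 R≢0 P-aniso R-aniso = begin
    σA (λ S → M P S ∧ M S R)
      ≡⟨ σ-cong (λ S _ → cong (anisotropicᵇ S ∧_) (distribute S)) ⟩
    σA (λ S → M S R xor (((P ∥ᵇ S) ∧ M S R) xor (K P S ∧ M S R)))
      ≡⟨ σA-xor₃ (λ S → M S R) (λ S → (P ∥ᵇ S) ∧ M S R) (λ S → K P S ∧ M S R) ⟩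
    σA (λ S → M S R) xor (σA (λ S → (P ∥ᵇ S) ∧ M S R) xor σA (λ S → K P S ∧ M S R))
      ≡⟨ cong₂ (λ m x → m xor (x xor σA (λ S → K P S ∧ M S R)))
               (σA-M R≢0 R-aniso) (σA-∥ P≢0 P-aniso _ (M-projectiveˡ R)) ⟩
    false xor (M P R xor σA (λ S → K P S ∧ M S R))
      ≡⟨ cong (M P R xor_) (σA-K-M P≢0 R≢0 P-aniso R-aniso) ⟩
    (not (P ∥ᵇ R) xor K P R) xor K P R
      ≡⟨ xor-assoc (not (P ∥ᵇ R)) (K P R) (K P R) ⟩
    not (P ∥ᵇ R) xor (K P R xor K P R)
      ≡⟨ cong (not (P ∥ᵇ R) xor_) (xor-same (K P R)) ⟩
    not (P ∥ᵇ R) xor false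
      ≡⟨ xor-identityʳ _ ⟩
    not (P ∥ᵇ R)
      ∎
    where
    distribute : ∀ S → (M P S ∧ M S R) ≡ (M S R xor (((P ∥ᵇ S) ∧ M S R) xor (K P S ∧ M S R)))
    distribute S = trans (cong (_∧ M S R) (M-unfold P S))
      (trans (∧-distribʳ-xor (M S R) true _) (cong (M S R xor_) (∧-distribʳ-xor (M S R) (P ∥ᵇ S) (K P S))))

module AnisotropicIncidence {q : ℕ} (F : FiniteField q) (q-odd : q % 2 ≡ 1) (α : FiniteField.Carrier F)
                            (α≉0 : ¬ FiniteField._≈_ F α (FiniteField.0# F)) where

  open import Data.Bool using (true; false; _∧_; not; if_then_else_)
  open import Data.Sum using (_⊎_; inj₁; inj₂)
  open import Data.Fin as Fin using (zero; suc)
  open import Data.List using (lookup)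
  import Data.List.Relation.Unary.All as All
  import Data.List.Relation.Unary.All.Properties as All
  open import Data.List.Relation.Unary.AllPairs using (AllPairs; _∷_)
  import Data.List.Relation.Unary.AllPairs.Properties as AllPairs
  open import Data.List.Membership.Propositional.Properties using (∈-lookup)
  open import Function using (_∘_)
  open import Relation.Nullary using (¬?; yes; no; contradiction)
  open import Relation.Nullary.Decidable using (⌊_⌋; isYes≗does)
  open import Relation.Binary.PropositionalEquality
  open ≡-Reasoning

  open F₂Sums
  open FieldFacts F using (_≟_; _≈_; 0#; ≉⇒≈ᵇ)
  open PG2 F α using (Q; points; aniso; N; pt; A₁₁)
  open Plane F α α≉0
  open Counting F q-odd α α≉0

  if-true-false : ∀ b → (if b then true else false) ≡ b
  if-true-false true  = refl
  if-true-false false = refl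

  AllPairs-lookup : ∀ {A : Set} {R : A → A → Set} {xs} → AllPairs R xs → ∀ i j → i ≢ j →
    R (lookup xs i) (lookup xs j) ⊎ R (lookup xs j) (lookup xs i)
  AllPairs-lookup (_  ∷ _)   zero    zero    i≢j = contradiction refl i≢j
  AllPairs-lookup (Rx ∷ _)   zero    (suc j) _   = inj₁ (All.lookup Rx (∈-lookup j))
  AllPairs-lookup (Rx ∷ _)   (suc i) zero    _   = inj₂ (All.lookup Rx (∈-lookup i))
  AllPairs-lookup (_  ∷ Rxs) (suc i) (suc j) i≢j = AllPairs-lookup Rxs i j (i≢j ∘ cong suc)

  pt-nonzero : ∀ k → NonZero₃ (pt k)
  pt-nonzero k = All.lookup (All.filter⁺ _ points-nonzero) (∈-lookup k)

  pt-anisotropic : ∀ k → isotropicᵇ (pt k) ≡ false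
  pt-anisotropic k = ≉⇒≈ᵇ (All.lookup (All.all-filter (λ P → ¬? (Q P ≟ 0#)) points) (∈-lookup k))

  ∑-pt : ∀ f → sum (λ k → f (pt k)) ≡ σA f
  ∑-pt f = trans (sumL-lookup f aniso)
    (trans (sumL-filter (λ P → ¬? (Q P ≟ 0#)) f points)
      (sumL-cong (All.universal (λ S → cong (λ b → not b ∧ f S) (sym (isYes≗does (Q S ≟ 0#)))) points)))

  pt-∥ᵇ : ∀ i j → (pt i ∥ᵇ pt j) ≡ ⌊ i Fin.≟ j ⌋
  pt-∥ᵇ i j with i Fin.≟ j
  ... | yes refl = ∥⇒∥ᵇ (∥-refl (pt i))
  ... | no  i≢j with AllPairs-lookup (AllPairs.filter⁺ _ points-distinct) i j i≢j
  ...   | inj₁ pᵢ∦pⱼ = ∦⇒∥ᵇ pᵢ∦pⱼ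
  ...   | inj₂ pⱼ∦pᵢ = ∦⇒∥ᵇ (pⱼ∦pᵢ ∘ ∥-sym)

  A₁₁≡⊥ᵇ : ∀ i j → A₁₁ i j ≡ (pt i ⊥ᵇ pt j)
  A₁₁≡⊥ᵇ i j = if-true-false _

  A₁₁²≡M : ∀ i j → (A₁₁ ⊗ A₁₁) i j ≡ M (pt i) (pt j)
  A₁₁²≡M i j = trans (sum-cong-≗ (λ k → cong₂ _∧_ (A₁₁≡⊥ᵇ i k) (A₁₁≡⊥ᵇ k j)))
                     (trans (∑-pt _) (σA-⊥⊥ (pt-nonzero i) (pt-nonzero j)))

  A₁₁²A₁₁²≡J-I : ∀ i j → ((A₁₁ ⊗ A₁₁) ⊗ (A₁₁ ⊗ A₁₁)) i j ≡ J-I i j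
  A₁₁²A₁₁²≡J-I i j = begin
    ((A₁₁ ⊗ A₁₁) ⊗ (A₁₁ ⊗ A₁₁)) i j
      ≡⟨ sum-cong-≗ (λ k → cong₂ _∧_ (A₁₁²≡M i k) (A₁₁²≡M k j)) ⟩
    sum (λ k → M (pt i) (pt k) ∧ M (pt k) (pt j))
      ≡⟨ ∑-pt _ ⟩
    σA (λ S → M (pt i) S ∧ M S (pt j))
      ≡⟨ σA-M-M (pt-nonzero i) (pt-nonzero j) (pt-anisotropic i) (pt-anisotropic j) ⟩
    not (pt i ∥ᵇ pt j)
      ≡⟨ cong not (trans (pt-∥ᵇ i j) (sym (if-true-false _))) ⟩
    J-I i j
      ∎

  A₁₁⁴≡J-I : ∀ i j → (A₁₁ ⊗ (A₁₁ ⊗ (A₁₁ ⊗ A₁₁))) i j ≡ J-I i j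
  A₁₁⁴≡J-I i j = trans (⊗-assoc A₁₁ A₁₁ (A₁₁ ⊗ A₁₁) i j) (A₁₁²A₁₁²≡J-I i j)

lemma3p5 : (q : ℕ) → IsPrimePower q → q % 2 ≡ 1 → (F : FiniteField q)
    → (α : FiniteField.Carrier F)
    → ¬ (FiniteField._≈_ F α (FiniteField.0# F))
    → (∃ λ β → FiniteField._≈_ F α (FiniteField._*_ F β β))
    → let open PG2 F α in
    ∀ (i j : Fin N) → (A₁₁ ⊗ (A₁₁ ⊗ (A₁₁ ⊗ A₁₁))) i j ≡ J-I i j
lemma3p5 q _ q-odd F α α≉0 _ = AnisotropicIncidence.A₁₁⁴≡J-I F q-odd α α≉0
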